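{- Let $P$ and $Q$ be finite posets. If $P$ and $Q$ are both mCDE, then $P\times Q$ is also mCDE.
   Context: For a finite poset $P$, $\mathrm{ddeg}(p)$ is the number of elements covered by $p$. A $k$-chain is a sequence $c_0<c_1<\dots<c_k$; let $r$ be the length of a longest chain of $P$. For $0\le k\le r$, the distribution $\mathrm{chain}(k)$ on $P$ is $\mathbb{P}(\mathrm{chain}(k);p)=\#\{k\text{ -chains } c \text{ with } p\in c\}/\big((k+1)\cdot\#\{k\text{ -chains}\}\big)$; $\mathrm{chain}(0)$ is the uniform distribution $\mathrm{uni}$. $P$ is mCDE if $\mathbb{E}(\mathrm{chain}(k);\mathrm{ddeg})=\mathbb{E}(\mathrm{uni};\mathrm{ddeg})$ for all $k=0,\dots,r$, where $\mathbb{E}(\mu;f)=\sum_p f(p)\mu(p)$. $P\times Q$ has the product order $(p,q)\le(p',q')$ iff $p\le p'$ and $q\le q'$. -}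

module Defs where

open import Level using (0ℓ)
open import Data.Bool using (Bool; true; false; _∧_; not; if_then_else_)
open import Data.Nat as ℕ using (ℕ; zero; suc)
open import Data.Nat.Properties as ℕP using ()
open import Data.Integer using (+_)
open import Data.Rational as ℚ using (ℚ; 0ℚ)
open import Data.List using (List; []; _∷_; length; filter; map; concatMap; foldr; cartesianProduct; upTo)
open import Data.List.Membership.Propositional using (_∈_)
open import Data.List.Membership.Propositional.Properties using (∈-cartesianProduct⁺)
open import Data.List.Relation.Unary.Unique.Propositional using (Unique)
import Data.List.Relation.Unary.Unique.Propositional.Properties as UniqueP
open import Data.List.Relation.Unary.Any using (any?)
open import Data.List.Relation.Unary.All using (all?)
open import Data.Vec using (Vec; []; _∷_; toList)
open import Data.Product using (_×_; _,_; proj₁; proj₂)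
open import Data.Product.Properties using (≡-dec)
open import Relation.Binary.Core using (Rel)
open import Relation.Binary.Structures using (IsDecPartialOrder; IsPartialOrder; IsPreorder)
open import Relation.Binary.PropositionalEquality using (_≡_; _≢_; refl; cong₂; isEquivalence)
open import Relation.Nullary using (¬_; Dec; yes; no; does)
open import Relation.Nullary.Decidable using (_×-dec_; ¬?)

record FinPoset : Set₁ where
  field
    Carrier  : Set
    _≤_      : Rel Carrier 0ℓ
    isDecPartialOrder : IsDecPartialOrder _≡_ _≤_
    elems    : List Carrier
    complete : ∀ x → x ∈ elems
    unique   : Unique elems

  open IsDecPartialOrder isDecPartialOrder public
    using (_≟_; _≤?_)

  _<_ : Rel Carrier 0ℓ
  x < y = x ≤ y × x ≢ y

  _<?_ : ∀ x y → Dec (x < y)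
  x <? y = (x ≤? y) ×-dec ¬? (x ≟ y)

  covers : Carrier → Carrier → Bool
  covers p x = does (x <? p) ∧ does (all? (λ z → ¬? ((x <? z) ×-dec (z <? p))) elems)

  ddeg : Carrier → ℕ
  ddeg p = length (filter (λ x → covers p x ≟ᵇ true) elems)
    where
      open import Data.Bool.Properties using () renaming (_≟_ to _≟ᵇ_)

  seqs : (n : ℕ) → List (Vec Carrier n)
  seqs zero    = [] ∷ []
  seqs (suc n) = concatMap (λ x → map (x ∷_) (seqs n)) elems

  increasing : ∀ {n} → Vec Carrier n → Bool
  increasing []           = true
  increasing (x ∷ [])     = true
  increasing (x ∷ y ∷ cs) = does (x <? y) ∧ increasing (y ∷ cs)

  chains : (k : ℕ) → List (Vec Carrier (suc k))
  chains k = filter (λ c → Data.Bool.Properties._≟_ (increasing c) true) (seqs (suc k))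
    where import Data.Bool.Properties

  #chains : ℕ → ℕ
  #chains k = length (chains k)

  #chainsThrough : ℕ → Carrier → ℕ
  #chainsThrough k p = length (filter (λ c → any? (λ q → p ≟ q) (toList c)) (chains k))

  -- r = length of a longest chain (a k-chain has k+1 distinct elements,
  -- so k < |P|; r is the largest such k for which a k-chain exists)
  rank : ℕ
  rank = foldr ℕ._⊔_ 0
           (filter (λ k → 1 ℕ.≤? #chains k) (upTo (length elems)))

-- Rational division of naturals (total; n ÷ 0 := 0 — never used on a
-- zero denominator in the statement for nonempty posets)

_÷_ : ℕ → ℕ → ℚ
n ÷ zero  = 0ℚ
n ÷ suc d = (+ n) ℚ./ suc d

sumℚ : List ℚ → ℚ
sumℚ = foldr ℚ._+_ 0ℚ

module _ (P : FinPoset) where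
  open FinPoset P

  uni : Carrier → ℚ
  uni p = 1 ÷ length elems

  chainDist : ℕ → Carrier → ℚ
  chainDist k p = #chainsThrough k p ÷ (suc k ℕ.* #chains k)

  𝔼 : (Carrier → ℚ) → (Carrier → ℕ) → ℚ
  𝔼 μ f = sumℚ (map (λ p → ((+ f p) ℚ./ 1) ℚ.* μ p) elems)

  mCDE : Set
  mCDE = ∀ k → k ℕ.≤ rank → 𝔼 (chainDist k) ddeg ≡ 𝔼 uni ddeg

module _ (P Q : FinPoset) where
  private
    module P = FinPoset P
    module Q = FinPoset Q
    module PP = IsDecPartialOrder P.isDecPartialOrder
    module QQ = IsDecPartialOrder Q.isDecPartialOrder

  _×≤_ : Rel (P.Carrier × Q.Carrier) 0ℓ
  (p , q) ×≤ (p' , q') = p P.≤ p' × q Q.≤ q'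

  ×-isDecPartialOrder : IsDecPartialOrder _≡_ _×≤_
  ×-isDecPartialOrder = record
    { isPartialOrder = record
      { isPreorder = record
        { isEquivalence = isEquivalence
        ; reflexive = λ { refl → PP.refl , QQ.refl }
        ; trans = λ (a , b) (c , d) → PP.trans a c , QQ.trans b d
        }
      ; antisym = λ (a , b) (c , d) → cong₂ _,_ (PP.antisym a c) (QQ.antisym b d)
      }
    ; _≟_  = ≡-dec PP._≟_ QQ._≟_
    ; _≤?_ = λ (p , q) (p' , q') → (p PP.≤? p') ×-dec (q QQ.≤? q')
    }

  _×P_ : FinPoset
  _×P_ = record
    { Carrier = P.Carrier × Q.Carrier
    ; _≤_ = _×≤_
    ; isDecPartialOrder = ×-isDecPartialOrder
    ; elems = cartesianProduct P.elems Q.elems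
    ; complete = λ (p , q) → ∈-cartesianProduct⁺ (P.complete p) (Q.complete q)
    ; unique = UniqueP.cartesianProduct⁺ P.unique Q.unique
    }

-- Let N = |P|, S = Σ_p ddeg p, C_k the number of k-chains and D_k = Σ_p ddeg p · #{k-chains through p}.
-- Clearing denominators, P is mCDE iff N · D_k = (k+1) · C_k · S for every k (above the rank both sides
-- vanish). Multichains x₀ ≼ … ≼ x_m are chains with repetitions, so their number M_m and the weighted count
-- E_m = Σ_p ddeg p · #{(multichain, position) with p at that position} are binomial transforms:
-- M_m = Σ_k C(m,k) C_k and E_m = Σ_k C(m+1,k+1) D_k. The binomial transform is invertible, hence the chain
-- identities for all k are equivalent to the multichain identities N · E_m = (m+1) · M_m · S for all m.
-- These are multiplicative: multichains of P × Q are pairs of multichains, and ddeg (p , q) = ddeg p + ddeg q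
-- since a cover in P × Q is a cover in one coordinate with the other fixed.

module Submission where

open import Data.Bool using (Bool; true; false; _∧_; _∨_; not)
import Data.Bool.Properties as Bool
open import Data.Empty using (⊥-elim)
open import Data.List using (List; []; _∷_; _++_; map; concatMap; cartesianProduct; length; filter; upTo)
open import Data.List.Membership.Propositional using (_∈_)
open import Data.List.Membership.Propositional.Properties using (∈-filter⁺; ∈-upTo⁺)
open import Data.List.Properties using (length-filter; foldr-preservesᵒ; foldr-preservesᵇ)
open import Data.List.Relation.Unary.All as All using (All; []; _∷_; all?)
open import Data.List.Relation.Unary.All.Properties using (all-filter)
open import Data.List.Relation.Unary.AllPairs using (_∷_)
open import Data.List.Relation.Unary.Any as Any using (here; there; any?)
open import Data.List.Relation.Unary.Unique.Propositional using (Unique)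
open import Data.Nat as ℕ using (ℕ; zero; suc; _+_; _*_; _⊔_; _≤_; _<_; _≤′_; ≤′-refl; ≤′-step; _≤?_; z≤n; s≤s)
open import Data.Nat.Combinatorics using (_C_; nCn≡1; nC1≡n; nCk+nC[k+1]≡[n+1]C[k+1])
open import Data.Nat.Combinatorics.Specification using (k>n⇒nCk≡0)
open import Data.Nat.Induction using (<-rec)
open import Data.Nat.Properties hiding (_≟_; _≤?_; _<?_)
open import Data.Nat.Tactic.RingSolver using (solve-∀)
open import Data.Product using (_×_; _,_; proj₁; proj₂; Σ-syntax)
open import Data.Rational as ℚ using (ℚ; 0ℚ)
import Data.Rational.Properties as ℚ
open import Data.Sum using (_⊎_; inj₁; inj₂)
open import Data.Vec using (Vec; _∷_; toList)
open import Function using (_∘_)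
import Relation.Binary.Construct.NonStrictToStrict as NonStrictToStrict
open import Relation.Binary.PropositionalEquality using (_≡_; _≢_; refl; sym; trans; cong; cong₂; subst; ≢-sym; module ≡-Reasoning)
open import Relation.Binary.Structures using (IsDecPartialOrder)
open import Relation.Nullary using (Dec; yes; no; does; ¬_)
open import Relation.Nullary.Decidable using (map′; _×-dec_; ¬?)
open import Relation.Unary using (Decidable)
open import Algebra.Properties.CommutativeSemigroup +-commutativeSemigroup using () renaming (interchange to +-interchange)
open import Algebra.Properties.CommutativeSemigroup *-commutativeSemigroup using () renaming (interchange to *-interchange; x∙yz≈y∙xz to x*[y*z]≡y*[x*z])

open import Defs

𝟙 : Bool → ℕ
𝟙 true  = 1
𝟙 false = 0

𝟙[_] : ∀ {a} {X : Set a} → Dec X → ℕ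
𝟙[ d ] = 𝟙 (does d)

𝟙-∧ : ∀ a b → 𝟙 (a ∧ b) ≡ 𝟙 a * 𝟙 b
𝟙-∧ true  b = sym (+-identityʳ (𝟙 b))
𝟙-∧ false b = refl

𝟙[≟true] : ∀ b → 𝟙[ b Bool.≟ true ] ≡ 𝟙 b
𝟙[≟true] true  = refl
𝟙[≟true] false = refl

𝟙[yes] : ∀ {X : Set} (d : Dec X) → X → 𝟙[ d ] ≡ 1
𝟙[yes] (yes _) _ = refl
𝟙[yes] (no ¬x) x = ⊥-elim (¬x x)

𝟙[no] : ∀ {X : Set} (d : Dec X) → ¬ X → 𝟙[ d ] ≡ 0
𝟙[no] (yes x) ¬x = ⊥-elim (¬x x)
𝟙[no] (no _)  _  = refl

𝟙[]≢0⇒ : ∀ {X : Set} (d : Dec X) → 𝟙[ d ] ≢ 0 → X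
𝟙[]≢0⇒ (yes x) _  = x
𝟙[]≢0⇒ (no _)  ≢0 = ⊥-elim (≢0 refl)

𝟙[]≤1 : ∀ {X : Set} (d : Dec X) → 𝟙[ d ] ≤ 1
𝟙[]≤1 (yes _) = s≤s z≤n
𝟙[]≤1 (no _)  = z≤n

𝟙[]-mono : ∀ {X Y : Set} (d : Dec X) (e : Dec Y) → (X → Y) → 𝟙[ d ] ≤ 𝟙[ e ]
𝟙[]-mono (yes x) e f = ≤-reflexive (sym (𝟙[yes] e (f x)))
𝟙[]-mono (no _)  e f = z≤n

𝟙[]-⇔ : ∀ {X Y : Set} (d : Dec X) (e : Dec Y) → (X → Y) → (Y → X) → 𝟙[ d ] ≡ 𝟙[ e ]
𝟙[]-⇔ (yes x) e f g = sym (𝟙[yes] e (f x))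
𝟙[]-⇔ (no ¬x) e f g = sym (𝟙[no] e (¬x ∘ g))

module _ {A : Set} where

  sumOver : List A → (A → ℕ) → ℕ
  sumOver []       f = 0
  sumOver (x ∷ xs) f = f x + sumOver xs f

  syntax sumOver xs (λ x → e) = ∑[ x ∈ xs ] e

  ∑-cong : ∀ xs {f g : A → ℕ} → (∀ x → f x ≡ g x) → ∑[ x ∈ xs ] f x ≡ ∑[ x ∈ xs ] g x
  ∑-cong []       f≗g = refl
  ∑-cong (x ∷ xs) f≗g = cong₂ _+_ (f≗g x) (∑-cong xs f≗g)

  ∑-zero : ∀ xs {f : A → ℕ} → (∀ x → f x ≡ 0) → ∑[ x ∈ xs ] f x ≡ 0
  ∑-zero []       f≗0 = refl
  ∑-zero (x ∷ xs) f≗0 = cong₂ _+_ (f≗0 x) (∑-zero xs f≗0)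

  ∑-distrib-+ : ∀ xs (f g : A → ℕ) → ∑[ x ∈ xs ] (f x + g x) ≡ ∑[ x ∈ xs ] f x + ∑[ x ∈ xs ] g x
  ∑-distrib-+ []       f g = refl
  ∑-distrib-+ (x ∷ xs) f g = begin
    f x + g x + ∑[ y ∈ xs ] (f y + g y)          ≡⟨ cong (f x + g x +_) (∑-distrib-+ xs f g) ⟩
    f x + g x + (∑[ y ∈ xs ] f y + ∑[ y ∈ xs ] g y) ≡⟨ +-interchange (f x) (g x) _ _ ⟩
    f x + ∑[ y ∈ xs ] f y + (g x + ∑[ y ∈ xs ] g y) ∎
    where open ≡-Reasoning

  *-distribˡ-∑ : ∀ c xs (f : A → ℕ) → c * ∑[ x ∈ xs ] f x ≡ ∑[ x ∈ xs ] (c * f x)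
  *-distribˡ-∑ c []       f = *-zeroʳ c
  *-distribˡ-∑ c (x ∷ xs) f = trans (*-distribˡ-+ c (f x) _) (cong (c * f x +_) (*-distribˡ-∑ c xs f))

  *-distribʳ-∑ : ∀ c xs (f : A → ℕ) → (∑[ x ∈ xs ] f x) * c ≡ ∑[ x ∈ xs ] (f x * c)
  *-distribʳ-∑ c xs f = trans (*-comm _ c) (trans (*-distribˡ-∑ c xs f) (∑-cong xs (λ x → *-comm c (f x))))

  ∑-++ : ∀ xs ys (f : A → ℕ) → ∑[ x ∈ xs ++ ys ] f x ≡ ∑[ x ∈ xs ] f x + ∑[ y ∈ ys ] f y
  ∑-++ []       ys f = refl
  ∑-++ (x ∷ xs) ys f = trans (cong (f x +_) (∑-++ xs ys f)) (sym (+-assoc (f x) _ _))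

  ∑-mono-≤ : ∀ xs {f g : A → ℕ} → (∀ x → f x ≤ g x) → ∑[ x ∈ xs ] f x ≤ ∑[ x ∈ xs ] g x
  ∑-mono-≤ []       f≤g = z≤n
  ∑-mono-≤ (x ∷ xs) f≤g = +-mono-≤ (f≤g x) (∑-mono-≤ xs f≤g)

  ∑≢0⇒∃≢0 : ∀ xs (f : A → ℕ) → ∑[ x ∈ xs ] f x ≢ 0 → Σ[ x ∈ A ] f x ≢ 0
  ∑≢0⇒∃≢0 []       f ≢0 = ⊥-elim (≢0 refl)
  ∑≢0⇒∃≢0 (x ∷ xs) f ≢0 with f x ℕ.≟ 0
  ... | no  fx≢0 = x , fx≢0
  ... | yes fx≡0 = ∑≢0⇒∃≢0 xs f (λ ∑≡0 → ≢0 (cong₂ _+_ fx≡0 ∑≡0))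

  length≡∑1 : ∀ xs → length xs ≡ ∑[ x ∈ xs ] 1
  length≡∑1 []       = refl
  length≡∑1 (x ∷ xs) = cong suc (length≡∑1 xs)

  module _ {P : A → Set} (P? : Decidable P) where

    ∑-filter : ∀ xs (f : A → ℕ) → ∑[ x ∈ filter P? xs ] f x ≡ ∑[ x ∈ xs ] (𝟙[ P? x ] * f x)
    ∑-filter []       f = refl
    ∑-filter (x ∷ xs) f with does (P? x)
    ... | true  = cong₂ _+_ (sym (+-identityʳ (f x))) (∑-filter xs f)
    ... | false = ∑-filter xs f

    length-filter≡∑𝟙 : ∀ xs → length (filter P? xs) ≡ ∑[ x ∈ xs ] 𝟙[ P? x ]
    length-filter≡∑𝟙 xs = begin
      length (filter P? xs)               ≡⟨ length≡∑1 (filter P? xs) ⟩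
      ∑[ x ∈ filter P? xs ] 1             ≡⟨ ∑-filter xs (λ _ → 1) ⟩
      ∑[ x ∈ xs ] (𝟙[ P? x ] * 1)         ≡⟨ ∑-cong xs (λ x → *-identityʳ 𝟙[ P? x ]) ⟩
      ∑[ x ∈ xs ] 𝟙[ P? x ]               ∎
      where open ≡-Reasoning

  module _ (_≟ᴬ_ : (x y : A) → Dec (x ≡ y)) (f : A → ℕ) where

    ∑-δ-absent : ∀ {xs} x → All (x ≢_) xs → ∑[ y ∈ xs ] (𝟙[ x ≟ᴬ y ] * f y) ≡ 0
    ∑-δ-absent x []           = refl
    ∑-δ-absent x (x≢y ∷ x∉xs) = cong₂ _+_ (cong (_* f _) (𝟙[no] (x ≟ᴬ _) x≢y)) (∑-δ-absent x x∉xs)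

    ∑-δ : ∀ {xs} x → Unique xs → x ∈ xs → ∑[ y ∈ xs ] (𝟙[ x ≟ᴬ y ] * f y) ≡ f x
    ∑-δ x (x∉xs ∷ _) (here refl) =
      trans (cong₂ _+_ (trans (cong (_* f x) (𝟙[yes] (x ≟ᴬ x) refl)) (+-identityʳ (f x))) (∑-δ-absent x x∉xs))
            (+-identityʳ (f x))
    ∑-δ x (z∉xs ∷ u) (there x∈xs) =
      cong₂ _+_ (cong (_* f _) (𝟙[no] (x ≟ᴬ _) (≢-sym (All.lookup z∉xs x∈xs)))) (∑-δ x u x∈xs)

∑-map : ∀ {A B : Set} (g : A → B) xs (f : B → ℕ) → ∑[ y ∈ map g xs ] f y ≡ ∑[ x ∈ xs ] f (g x)
∑-map g []       f = refl
∑-map g (x ∷ xs) f = cong (f (g x) +_) (∑-map g xs f)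

module _ {A B : Set} where

  ∑-concatMap : ∀ (g : A → List B) xs (f : B → ℕ) →
                ∑[ y ∈ concatMap g xs ] f y ≡ ∑[ x ∈ xs ] ∑[ y ∈ g x ] f y
  ∑-concatMap g []       f = refl
  ∑-concatMap g (x ∷ xs) f = trans (∑-++ (g x) (concatMap g xs) f) (cong (_ +_) (∑-concatMap g xs f))

  ∑-cartesianProduct : ∀ xs ys (f : A × B → ℕ) →
                       ∑[ z ∈ cartesianProduct xs ys ] f z ≡ ∑[ x ∈ xs ] ∑[ y ∈ ys ] f (x , y)
  ∑-cartesianProduct []       ys f = refl
  ∑-cartesianProduct (x ∷ xs) ys f =
    trans (∑-++ (map (x ,_) ys) _ f) (cong₂ _+_ (∑-map (x ,_) ys f) (∑-cartesianProduct xs ys f))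

  ∑-comm : ∀ xs ys (f : A → B → ℕ) → ∑[ x ∈ xs ] ∑[ y ∈ ys ] f x y ≡ ∑[ y ∈ ys ] ∑[ x ∈ xs ] f x y
  ∑-comm []       ys f = sym (∑-zero ys (λ _ → refl))
  ∑-comm (x ∷ xs) ys f = trans (cong (_ +_) (∑-comm xs ys f)) (sym (∑-distrib-+ ys (f x) _))

  ∑-*-∑ : ∀ xs ys (f : A → ℕ) (g : B → ℕ) →
          ∑[ x ∈ xs ] ∑[ y ∈ ys ] (f x * g y) ≡ ∑[ x ∈ xs ] f x * ∑[ y ∈ ys ] g y
  ∑-*-∑ xs ys f g = trans (∑-cong xs (λ x → sym (*-distribˡ-∑ (f x) ys g))) (sym (*-distribʳ-∑ _ xs f))

∑< : ℕ → (ℕ → ℕ) → ℕ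
∑< zero    a = 0
∑< (suc n) a = a 0 + ∑< n (a ∘ suc)

syntax ∑< n (λ i → e) = ∑[ i < n ] e

∑<-cong : ∀ n {a b : ℕ → ℕ} → (∀ i → i < n → a i ≡ b i) → ∑[ i < n ] a i ≡ ∑[ i < n ] b i
∑<-cong zero    a≗b = refl
∑<-cong (suc n) a≗b = cong₂ _+_ (a≗b 0 (s≤s z≤n)) (∑<-cong n (λ i i<n → a≗b (suc i) (s≤s i<n)))

∑<-distrib-+ : ∀ n (a b : ℕ → ℕ) → ∑[ i < n ] (a i + b i) ≡ ∑[ i < n ] a i + ∑[ i < n ] b i
∑<-distrib-+ zero    a b = refl
∑<-distrib-+ (suc n) a b =
  trans (cong (a 0 + b 0 +_) (∑<-distrib-+ n (a ∘ suc) (b ∘ suc))) (+-interchange (a 0) (b 0) _ _)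

*-distribˡ-∑< : ∀ c n (a : ℕ → ℕ) → c * ∑[ i < n ] a i ≡ ∑[ i < n ] (c * a i)
*-distribˡ-∑< c zero    a = *-zeroʳ c
*-distribˡ-∑< c (suc n) a = trans (*-distribˡ-+ c (a 0) _) (cong (c * a 0 +_) (*-distribˡ-∑< c n (a ∘ suc)))

∑<-init-last : ∀ n (a : ℕ → ℕ) → ∑[ i < suc n ] a i ≡ ∑[ i < n ] a i + a n
∑<-init-last zero    a = +-identityʳ (a 0)
∑<-init-last (suc n) a = trans (cong (a 0 +_) (∑<-init-last n (a ∘ suc))) (sym (+-assoc (a 0) _ _))

∑-∑<-comm : ∀ {A : Set} (xs : List A) n (f : A → ℕ → ℕ) →
            ∑[ x ∈ xs ] ∑[ i < n ] f x i ≡ ∑[ i < n ] ∑[ x ∈ xs ] f x i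
∑-∑<-comm xs zero    f = ∑-zero xs (λ _ → refl)
∑-∑<-comm xs (suc n) f =
  trans (∑-distrib-+ xs (λ x → f x 0) _) (cong (_ +_) (∑-∑<-comm xs n (λ x i → f x (suc i))))

[1+m]*mCk≡[1+k]*[1+m]C[1+k] : ∀ m k → suc m * (m C k) ≡ suc k * (suc m C suc k)
[1+m]*mCk≡[1+k]*[1+m]C[1+k] zero    zero    = refl
[1+m]*mCk≡[1+k]*[1+m]C[1+k] zero    (suc k) = sym (*-zeroʳ (suc (suc k)))
[1+m]*mCk≡[1+k]*[1+m]C[1+k] (suc m) zero    =
  trans (*-identityʳ (suc (suc m))) (sym (trans (+-identityʳ _) (nC1≡n (suc (suc m)))))
[1+m]*mCk≡[1+k]*[1+m]C[1+k] (suc m) (suc k) = begin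
  suc (suc m) * (suc m C suc k)
    ≡⟨ cong (suc (suc m) *_) (sym (nCk+nC[k+1]≡[n+1]C[k+1] m k)) ⟩
  suc (suc m) * (a + b)
    ≡⟨ expand (suc m) a b ⟩
  suc m * a + a + (suc m * b + b)
    ≡⟨ cong₂ (λ x y → x + a + (y + b))
         (trans ([1+m]*mCk≡[1+k]*[1+m]C[1+k] m k) (cong (suc k *_) (sym (nCk+nC[k+1]≡[n+1]C[k+1] m k))))
         ([1+m]*mCk≡[1+k]*[1+m]C[1+k] m (suc k)) ⟩
  suc k * (a + b) + a + (suc (suc k) * c + b)
    ≡⟨ collect (suc k) a b c ⟩
  suc (suc k) * (a + b + c)
    ≡⟨ cong (suc (suc k) *_) (trans (cong (_+ c) (nCk+nC[k+1]≡[n+1]C[k+1] m k)) (nCk+nC[k+1]≡[n+1]C[k+1] (suc m) (suc k))) ⟩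
  suc (suc k) * (suc (suc m) C suc (suc k)) ∎
  where
  open ≡-Reasoning
  a = m C k
  b = m C suc k
  c = suc m C suc (suc k)
  expand : ∀ x a b → suc x * (a + b) ≡ x * a + a + (x * b + b)
  expand = solve-∀
  collect : ∀ x a b c → x * (a + b) + a + (suc x * c + b) ≡ suc x * (a + b + c)
  collect = solve-∀

-- _C_ binds more weakly than _*_, hence the parentheses around n C s.
binomialTransform : ℕ → (ℕ → ℕ) → ℕ
binomialTransform n a = ∑[ s < suc n ] ((n C s) * a s)

-- binomialTransform (suc m) (shift c) = Σ_{k ≤ m} C(m+1, k+1) · c k
shift : (ℕ → ℕ) → ℕ → ℕ
shift a zero    = 0
shift a (suc k) = a k

binomialTransform-zero : ∀ a → binomialTransform 0 a ≡ a 0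
binomialTransform-zero a = trans (+-identityʳ (1 * a 0)) (*-identityˡ (a 0))

binomialTransform-cong : ∀ n {a b : ℕ → ℕ} → (∀ s → a s ≡ b s) → binomialTransform n a ≡ binomialTransform n b
binomialTransform-cong n a≗b = ∑<-cong (suc n) (λ s _ → cong ((n C s) *_) (a≗b s))

binomialTransform-distrib-+ : ∀ n (a b : ℕ → ℕ) →
  binomialTransform n (λ s → a s + b s) ≡ binomialTransform n a + binomialTransform n b
binomialTransform-distrib-+ n a b = trans
  (∑<-cong (suc n) (λ s _ → *-distribˡ-+ (n C s) (a s) (b s)))
  (∑<-distrib-+ (suc n) (λ s → (n C s) * a s) (λ s → (n C s) * b s))

*-distribˡ-binomialTransform : ∀ c n (a : ℕ → ℕ) →
  c * binomialTransform n a ≡ binomialTransform n (λ s → c * a s)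
*-distribˡ-binomialTransform c n a = trans
  (*-distribˡ-∑< c (suc n) (λ s → (n C s) * a s))
  (∑<-cong (suc n) (λ s _ → x*[y*z]≡y*[x*z] c (n C s) (a s)))

*-distribʳ-binomialTransform : ∀ c n (a : ℕ → ℕ) →
  binomialTransform n a * c ≡ binomialTransform n (λ s → a s * c)
*-distribʳ-binomialTransform c n a = trans (*-comm _ c) (trans (*-distribˡ-binomialTransform c n a)
  (binomialTransform-cong n (λ s → *-comm c (a s))))

∑-binomialTransform-comm : ∀ {A : Set} (xs : List A) n (f : A → ℕ → ℕ) →
  ∑[ x ∈ xs ] binomialTransform n (f x) ≡ binomialTransform n (λ s → ∑[ x ∈ xs ] f x s)
∑-binomialTransform-comm xs n f = begin
  ∑[ x ∈ xs ] ∑[ s < suc n ] ((n C s) * f x s)   ≡⟨ ∑-∑<-comm xs (suc n) (λ x s → (n C s) * f x s) ⟩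
  ∑[ s < suc n ] ∑[ x ∈ xs ] ((n C s) * f x s)
    ≡⟨ ∑<-cong (suc n) (λ s _ → sym (*-distribˡ-∑ (n C s) xs (λ x → f x s))) ⟩
  ∑[ s < suc n ] ((n C s) * ∑[ x ∈ xs ] f x s)   ∎
  where open ≡-Reasoning

binomialTransform-suc : ∀ n a →
  binomialTransform (suc n) a ≡ binomialTransform n a + binomialTransform n (a ∘ suc)
binomialTransform-suc n a = begin
  1 * a 0 + ∑[ s < suc n ] ((suc n C suc s) * a (suc s))
    ≡⟨ cong (1 * a 0 +_) (trans
         (∑<-cong (suc n) (λ s _ → cong (_* a (suc s)) (sym (nCk+nC[k+1]≡[n+1]C[k+1] n s))))
         split-pascal) ⟩
  1 * a 0 + (binomialTransform n (a ∘ suc) + ∑[ s < suc n ] ((n C suc s) * a (suc s)))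
    ≡⟨ x+[y+z]≡x+z+y (1 * a 0) _ _ ⟩
  ∑[ s < suc (suc n) ] ((n C s) * a s) + binomialTransform n (a ∘ suc)
    ≡⟨ cong (_+ binomialTransform n (a ∘ suc)) extend ⟩
  binomialTransform n a + binomialTransform n (a ∘ suc) ∎
  where
  open ≡-Reasoning
  x+[y+z]≡x+z+y : ∀ x y z → x + (y + z) ≡ x + z + y
  x+[y+z]≡x+z+y = solve-∀
  split-pascal : ∑[ s < suc n ] ((n C s + n C suc s) * a (suc s)) ≡
    binomialTransform n (a ∘ suc) + ∑[ s < suc n ] ((n C suc s) * a (suc s))
  split-pascal = trans
    (∑<-cong (suc n) (λ s _ → *-distribʳ-+ (a (suc s)) (n C s) (n C suc s)))
    (∑<-distrib-+ (suc n) (λ s → (n C s) * a (suc s)) (λ s → (n C suc s) * a (suc s)))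
  extend : ∑[ s < suc (suc n) ] ((n C s) * a s) ≡ binomialTransform n a
  extend = begin
    ∑[ s < suc (suc n) ] ((n C s) * a s)              ≡⟨ ∑<-init-last (suc n) (λ s → (n C s) * a s) ⟩
    binomialTransform n a + (n C suc n) * a (suc n)
      ≡⟨ cong (λ c → binomialTransform n a + c * a (suc n)) (k>n⇒nCk≡0 (n<1+n n)) ⟩
    binomialTransform n a + 0                       ≡⟨ +-identityʳ (binomialTransform n a) ⟩
    binomialTransform n a                           ∎

binomialTransform-init-last : ∀ n a → binomialTransform n a ≡ ∑[ s < n ] ((n C s) * a s) + a n
binomialTransform-init-last n a = trans (∑<-init-last n (λ s → (n C s) * a s))
  (cong (∑[ s < n ] ((n C s) * a s) +_) (trans (cong (_* a n) (nCn≡1 n)) (*-identityˡ (a n))))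

binomialTransform-injective : ∀ {a b : ℕ → ℕ} →
  (∀ n → binomialTransform n a ≡ binomialTransform n b) → ∀ n → a n ≡ b n
binomialTransform-injective {a} {b} bta≡btb = <-rec (λ n → a n ≡ b n) step
  where
  step : ∀ n → (∀ {s} → s < n → a s ≡ b s) → a n ≡ b n
  step n ih = +-cancelˡ-≡ (∑[ s < n ] ((n C s) * a s)) (a n) (b n) (begin
    ∑[ s < n ] ((n C s) * a s) + a n   ≡⟨ sym (binomialTransform-init-last n a) ⟩
    binomialTransform n a              ≡⟨ bta≡btb n ⟩
    binomialTransform n b              ≡⟨ binomialTransform-init-last n b ⟩
    ∑[ s < n ] ((n C s) * b s) + b n   ≡⟨ cong (_+ b n) (∑<-cong n (λ s s<n → cong ((n C s) *_) (sym (ih s<n)))) ⟩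
    ∑[ s < n ] ((n C s) * a s) + b n   ∎)
    where open ≡-Reasoning

suc-*-binomialTransform : ∀ m a → suc m * binomialTransform m a ≡ binomialTransform (suc m) (shift (λ k → suc k * a k))
suc-*-binomialTransform m a = begin
  suc m * ∑[ s < suc m ] ((m C s) * a s)           ≡⟨ *-distribˡ-∑< (suc m) (suc m) (λ s → (m C s) * a s) ⟩
  ∑[ s < suc m ] (suc m * ((m C s) * a s))         ≡⟨ ∑<-cong (suc m) (λ s _ → absorb s) ⟩
  ∑[ s < suc m ] ((suc m C suc s) * (suc s * a s)) ∎
  where
  open ≡-Reasoning
  absorb : ∀ s → suc m * ((m C s) * a s) ≡ (suc m C suc s) * (suc s * a s)
  absorb s = begin
    suc m * ((m C s) * a s)             ≡⟨ sym (*-assoc (suc m) (m C s) (a s)) ⟩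
    suc m * (m C s) * a s               ≡⟨ cong (_* a s) ([1+m]*mCk≡[1+k]*[1+m]C[1+k] m s) ⟩
    suc s * (suc m C suc s) * a s       ≡⟨ cong (_* a s) (*-comm (suc s) (suc m C suc s)) ⟩
    (suc m C suc s) * suc s * a s       ≡⟨ *-assoc (suc m C suc s) (suc s) (a s) ⟩
    (suc m C suc s) * (suc s * a s)     ∎

∑antidiagonal : ℕ → (ℕ → ℕ → ℕ) → ℕ
∑antidiagonal zero    F = F 0 0
∑antidiagonal (suc m) F = F 0 (suc m) + ∑antidiagonal m (λ i l → F (suc i) l)

syntax ∑antidiagonal m (λ i l → e) = ∑[ i + l ≡ m ] e

∑antidiagonal-cong : ∀ m {F G : ℕ → ℕ → ℕ} → (∀ i l → i + l ≡ m → F i l ≡ G i l) →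
                     ∑[ i + l ≡ m ] F i l ≡ ∑[ i + l ≡ m ] G i l
∑antidiagonal-cong zero    F≗G = F≗G 0 0 refl
∑antidiagonal-cong (suc m) F≗G =
  cong₂ _+_ (F≗G 0 (suc m) refl) (∑antidiagonal-cong m (λ i l i+l≡m → F≗G (suc i) l (cong suc i+l≡m)))

∑antidiagonal-distrib-+ : ∀ m (F G : ℕ → ℕ → ℕ) →
  ∑[ i + l ≡ m ] (F i l + G i l) ≡ ∑[ i + l ≡ m ] F i l + ∑[ i + l ≡ m ] G i l
∑antidiagonal-distrib-+ zero    F G = refl
∑antidiagonal-distrib-+ (suc m) F G =
  trans (cong (F 0 (suc m) + G 0 (suc m) +_) (∑antidiagonal-distrib-+ m (λ i l → F (suc i) l) (λ i l → G (suc i) l)))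
        (+-interchange (F 0 (suc m)) (G 0 (suc m)) _ _)

*-distribˡ-∑antidiagonal : ∀ c m (F : ℕ → ℕ → ℕ) → c * ∑[ i + l ≡ m ] F i l ≡ ∑[ i + l ≡ m ] (c * F i l)
*-distribˡ-∑antidiagonal c zero    F = refl
*-distribˡ-∑antidiagonal c (suc m) F =
  trans (*-distribˡ-+ c _ _) (cong (c * F 0 (suc m) +_) (*-distribˡ-∑antidiagonal c m (λ i l → F (suc i) l)))

*-distribʳ-∑antidiagonal : ∀ c m (F : ℕ → ℕ → ℕ) → (∑[ i + l ≡ m ] F i l) * c ≡ ∑[ i + l ≡ m ] (F i l * c)
*-distribʳ-∑antidiagonal c m F = trans (*-comm _ c) (trans (*-distribˡ-∑antidiagonal c m F)
  (∑antidiagonal-cong m (λ i l _ → *-comm c (F i l))))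


∑-∑antidiagonal-comm : ∀ {A : Set} (xs : List A) m (F : A → ℕ → ℕ → ℕ) →
  ∑[ x ∈ xs ] ∑[ i + l ≡ m ] F x i l ≡ ∑[ i + l ≡ m ] ∑[ x ∈ xs ] F x i l
∑-∑antidiagonal-comm xs zero    F = refl
∑-∑antidiagonal-comm xs (suc m) F =
  trans (∑-distrib-+ xs (λ x → F x 0 (suc m)) (λ x → ∑[ i + l ≡ m ] F x (suc i) l))
        (cong (∑[ x ∈ xs ] F x 0 (suc m) +_) (∑-∑antidiagonal-comm xs m (λ x i l → F x (suc i) l)))

convolution : ℕ → (ℕ → ℕ) → (ℕ → ℕ) → ℕ
convolution k α β = ∑[ s + t ≡ k ] (α s * β t)

convolution-head : ∀ α β k → convolution k α β ≡ α 0 * β k + shift (λ j → convolution j (α ∘ suc) β) k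
convolution-head α β zero    = sym (+-identityʳ (α 0 * β 0))
convolution-head α β (suc k) = refl

-- Σ_{i+l=m} C(i,s) C(l,t) = C(m+1, s+t+1), summed against α s β t.
∑antidiagonal-binomialTransform : ∀ m α β →
  ∑[ i + l ≡ m ] (binomialTransform i α * binomialTransform l β) ≡
  binomialTransform (suc m) (shift (λ k → convolution k α β))
∑antidiagonal-binomialTransform zero    α β =
  trans (cong₂ _*_ (binomialTransform-zero α) (binomialTransform-zero β))
        (sym (trans (+-identityʳ _) (*-identityˡ _)))
∑antidiagonal-binomialTransform (suc m) α β = begin
  bt 0 α * bt (suc m) β + ∑[ i + l ≡ m ] (bt (suc i) α * bt l β)
    ≡⟨ cong₂ _+_ (cong (_* bt (suc m) β) (binomialTransform-zero α)) (trans
         (∑antidiagonal-cong m (λ i l _ → trans (cong (_* bt l β) (binomialTransform-suc i α))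
                                               (*-distribʳ-+ (bt l β) (bt i α) (bt i α′ ))))
         (∑antidiagonal-distrib-+ m (λ i l → bt i α * bt l β) (λ i l → bt i α′ * bt l β))) ⟩
  α 0 * bt (suc m) β + (∑[ i + l ≡ m ] (bt i α * bt l β) + ∑[ i + l ≡ m ] (bt i α′ * bt l β))
    ≡⟨ cong (λ x → α 0 * bt (suc m) β + x)
         (cong₂ _+_ (∑antidiagonal-binomialTransform m α β) (∑antidiagonal-binomialTransform m α′ β)) ⟩
  α 0 * bt (suc m) β + (bt (suc m) (shift conv) + bt (suc m) (shift conv′))
    ≡⟨ x+[y+z]≡y+[x+z] (α 0 * bt (suc m) β) (bt (suc m) (shift conv)) (bt (suc m) (shift conv′)) ⟩
  bt (suc m) (shift conv) + (α 0 * bt (suc m) β + bt (suc m) (shift conv′))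
    ≡⟨ cong (bt (suc m) (shift conv) +_) (sym head) ⟩
  bt (suc m) (shift conv) + bt (suc m) conv
    ≡⟨ sym (binomialTransform-suc (suc m) (shift conv)) ⟩
  bt (suc (suc m)) (shift conv) ∎
  where
  open ≡-Reasoning
  bt = binomialTransform
  α′ = α ∘ suc
  conv conv′ : ℕ → ℕ
  conv  k = convolution k α β
  conv′ k = convolution k α′ β
  x+[y+z]≡y+[x+z] : ∀ x y z → x + (y + z) ≡ y + (x + z)
  x+[y+z]≡y+[x+z] = solve-∀
  head : bt (suc m) conv ≡ α 0 * bt (suc m) β + bt (suc m) (shift conv′)
  head = begin
    bt (suc m) conv                                      ≡⟨ binomialTransform-cong (suc m) (convolution-head α β) ⟩
    bt (suc m) (λ k → α 0 * β k + shift conv′ k)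
      ≡⟨ binomialTransform-distrib-+ (suc m) (λ k → α 0 * β k) (shift conv′) ⟩
    bt (suc m) (λ k → α 0 * β k) + bt (suc m) (shift conv′)
      ≡⟨ cong (_+ bt (suc m) (shift conv′)) (sym (*-distribˡ-binomialTransform (α 0) (suc m) β)) ⟩
    α 0 * bt (suc m) β + bt (suc m) (shift conv′)        ∎

module Walks {A : Set} (elems : List A) where

  walksFrom : (A → A → ℕ) → ℕ → A → ℕ
  walksFrom r zero    x = 1
  walksFrom r (suc n) x = ∑[ y ∈ elems ] (r x y * walksFrom r n y)

  pushforward : (A → A → ℕ) → (A → ℕ) → A → ℕ
  pushforward r U y = ∑[ x ∈ elems ] (U x * r x y)

  -- walksInto r U i y = Σ_x U x · (number of r-weighted walks of length i from x to y)
  walksInto : (A → A → ℕ) → (A → ℕ) → ℕ → A → ℕ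
  walksInto r U zero    = U
  walksInto r U (suc i) = walksInto r (pushforward r U) i

  walksInto-cong : ∀ r {U V : A → ℕ} → (∀ x → U x ≡ V x) → ∀ i y → walksInto r U i y ≡ walksInto r V i y
  walksInto-cong r U≗V zero    y = U≗V y
  walksInto-cong r U≗V (suc i) y =
    walksInto-cong r (λ z → ∑-cong elems (λ x → cong (_* r x z) (U≗V x))) i y

  walksInto-distrib-+ : ∀ r (U V : A → ℕ) i y →
    walksInto r (λ x → U x + V x) i y ≡ walksInto r U i y + walksInto r V i y
  walksInto-distrib-+ r U V zero    y = refl
  walksInto-distrib-+ r U V (suc i) y = trans
    (walksInto-cong r (λ z → trans (∑-cong elems (λ x → *-distribʳ-+ (r x z) (U x) (V x)))
                                   (∑-distrib-+ elems (λ x → U x * r x z) (λ x → V x * r x z))) i y)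
    (walksInto-distrib-+ r (pushforward r U) (pushforward r V) i y)

  -- A walk of length i + l splits at its i-th vertex.
  ∑-walksInto-walksFrom : ∀ r i l (U : A → ℕ) →
    ∑[ y ∈ elems ] (walksInto r U i y * walksFrom r l y) ≡ ∑[ y ∈ elems ] (U y * walksFrom r (i + l) y)
  ∑-walksInto-walksFrom r zero    l U = refl
  ∑-walksInto-walksFrom r (suc i) l U = begin
    ∑[ y ∈ elems ] (walksInto r (pushforward r U) i y * walksFrom r l y)
      ≡⟨ ∑-walksInto-walksFrom r i l (pushforward r U) ⟩
    ∑[ y ∈ elems ] (∑[ x ∈ elems ] (U x * r x y) * w y)
      ≡⟨ ∑-cong elems (λ y → *-distribʳ-∑ (w y) elems (λ x → U x * r x y)) ⟩
    ∑[ y ∈ elems ] ∑[ x ∈ elems ] (U x * r x y * w y)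
      ≡⟨ ∑-comm elems elems (λ y x → U x * r x y * w y) ⟩
    ∑[ x ∈ elems ] ∑[ y ∈ elems ] (U x * r x y * w y)
      ≡⟨ ∑-cong elems (λ x → trans (∑-cong elems (λ y → *-assoc (U x) (r x y) (w y)))
                                   (sym (*-distribˡ-∑ (U x) elems (λ y → r x y * w y)))) ⟩
    ∑[ x ∈ elems ] (U x * walksFrom r (suc (i + l)) x) ∎
    where
    open ≡-Reasoning
    w = walksFrom r (i + l)

  module _ (_≟ᴬ_ : (x y : A) → Dec (x ≡ y)) (complete : ∀ x → x ∈ elems) (unique : Unique elems) where

    δ-sumˡ : ∀ x (f : A → ℕ) → ∑[ y ∈ elems ] (𝟙[ x ≟ᴬ y ] * f y) ≡ f x
    δ-sumˡ x f = ∑-δ _≟ᴬ_ f x unique (complete x)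

    δ-sumʳ : ∀ y (U : A → ℕ) → ∑[ x ∈ elems ] (U x * 𝟙[ x ≟ᴬ y ]) ≡ U y
    δ-sumʳ y U = trans
      (∑-cong elems (λ x → trans (*-comm (U x) _) (cong (_* U x) (𝟙[]-⇔ (x ≟ᴬ y) (y ≟ᴬ x) sym sym))))
      (δ-sumˡ y U)

    module _ (r R : A → A → ℕ) (R≡δ+r : ∀ x y → R x y ≡ 𝟙[ x ≟ᴬ y ] + r x y) where

      walksFrom-δ+ : ∀ n x → walksFrom R n x ≡ binomialTransform n (λ s → walksFrom r s x)
      walksFrom-δ+ zero    x = sym (binomialTransform-zero (λ s → walksFrom r s x))
      walksFrom-δ+ (suc n) x = begin
        ∑[ y ∈ elems ] (R x y * walksFrom R n y)
          ≡⟨ ∑-cong elems (λ y → trans (cong (_* walksFrom R n y) (R≡δ+r x y))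
                                       (*-distribʳ-+ (walksFrom R n y) 𝟙[ x ≟ᴬ y ] (r x y))) ⟩
        ∑[ y ∈ elems ] (𝟙[ x ≟ᴬ y ] * walksFrom R n y + r x y * walksFrom R n y)
          ≡⟨ ∑-distrib-+ elems (λ y → 𝟙[ x ≟ᴬ y ] * walksFrom R n y) (λ y → r x y * walksFrom R n y) ⟩
        ∑[ y ∈ elems ] (𝟙[ x ≟ᴬ y ] * walksFrom R n y) + ∑[ y ∈ elems ] (r x y * walksFrom R n y)
          ≡⟨ cong₂ _+_ (trans (δ-sumˡ x (walksFrom R n)) (walksFrom-δ+ n x))
                       (∑-cong elems (λ y → cong (r x y *_) (walksFrom-δ+ n y))) ⟩
        binomialTransform n (λ s → walksFrom r s x) + ∑[ y ∈ elems ] (r x y * binomialTransform n (λ s → walksFrom r s y))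
          ≡⟨ cong (binomialTransform n (λ s → walksFrom r s x) +_) step ⟩
        binomialTransform n (λ s → walksFrom r s x) + binomialTransform n (λ s → walksFrom r (suc s) x)
          ≡⟨ sym (binomialTransform-suc n (λ s → walksFrom r s x)) ⟩
        binomialTransform (suc n) (λ s → walksFrom r s x) ∎
        where
        open ≡-Reasoning
        step : ∑[ y ∈ elems ] (r x y * binomialTransform n (λ s → walksFrom r s y)) ≡
               binomialTransform n (λ s → walksFrom r (suc s) x)
        step = trans (∑-cong elems (λ y → *-distribˡ-binomialTransform (r x y) n (λ s → walksFrom r s y)))
                     (∑-binomialTransform-comm elems n (λ y s → r x y * walksFrom r s y))

      pushforward-δ+ : ∀ U y → pushforward R U y ≡ U y + pushforward r U y
      pushforward-δ+ U y = begin
        ∑[ x ∈ elems ] (U x * R x y)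
          ≡⟨ ∑-cong elems (λ x → trans (cong (U x *_) (R≡δ+r x y)) (*-distribˡ-+ (U x) 𝟙[ x ≟ᴬ y ] (r x y))) ⟩
        ∑[ x ∈ elems ] (U x * 𝟙[ x ≟ᴬ y ] + U x * r x y)
          ≡⟨ ∑-distrib-+ elems (λ x → U x * 𝟙[ x ≟ᴬ y ]) (λ x → U x * r x y) ⟩
        ∑[ x ∈ elems ] (U x * 𝟙[ x ≟ᴬ y ]) + pushforward r U y
          ≡⟨ cong (_+ pushforward r U y) (δ-sumʳ y U) ⟩
        U y + pushforward r U y ∎
        where open ≡-Reasoning

      walksInto-δ+ : ∀ i U y → walksInto R U i y ≡ binomialTransform i (λ s → walksInto r U s y)
      walksInto-δ+ zero    U y = sym (binomialTransform-zero (λ s → walksInto r U s y))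
      walksInto-δ+ (suc i) U y = begin
        walksInto R (pushforward R U) i y
          ≡⟨ walksInto-δ+ i (pushforward R U) y ⟩
        binomialTransform i (λ s → walksInto r (pushforward R U) s y)
          ≡⟨ binomialTransform-cong i (λ s → trans (walksInto-cong r (pushforward-δ+ U) s y)
                                                   (walksInto-distrib-+ r U (pushforward r U) s y)) ⟩
        binomialTransform i (λ s → walksInto r U s y + walksInto r U (suc s) y)
          ≡⟨ binomialTransform-distrib-+ i (λ s → walksInto r U s y) (λ s → walksInto r U (suc s) y) ⟩
        binomialTransform i (λ s → walksInto r U s y) + binomialTransform i (λ s → walksInto r U (suc s) y)
          ≡⟨ sym (binomialTransform-suc i (λ s → walksInto r U s y)) ⟩
        binomialTransform (suc i) (λ s → walksInto r U s y) ∎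
        where open ≡-Reasoning

module _ {A B : Set} (as : List A) (bs : List B) (r : A → A → ℕ) (s : B → B → ℕ) (R : A × B → A × B → ℕ)
         (R≡r*s : ∀ x y x′ y′ → R (x , y) (x′ , y′) ≡ r x x′ * s y y′) where
  private
    module WA = Walks as
    module WB = Walks bs
    module W  = Walks (cartesianProduct as bs)

  walksFrom-× : ∀ n x y → W.walksFrom R n (x , y) ≡ WA.walksFrom r n x * WB.walksFrom s n y
  walksFrom-× zero    x y = refl
  walksFrom-× (suc n) x y = begin
    ∑[ z ∈ cartesianProduct as bs ] (R (x , y) z * W.walksFrom R n z)
      ≡⟨ ∑-cartesianProduct as bs _ ⟩
    ∑[ x′ ∈ as ] ∑[ y′ ∈ bs ] (R (x , y) (x′ , y′) * W.walksFrom R n (x′ , y′))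
      ≡⟨ ∑-cong as (λ x′ → ∑-cong bs (λ y′ → trans (cong₂ _*_ (R≡r*s x y x′ y′) (walksFrom-× n x′ y′))
                                                    (*-interchange (r x x′) (s y y′) _ _))) ⟩
    ∑[ x′ ∈ as ] ∑[ y′ ∈ bs ] (r x x′ * WA.walksFrom r n x′ * (s y y′ * WB.walksFrom s n y′))
      ≡⟨ ∑-*-∑ as bs (λ x′ → r x x′ * WA.walksFrom r n x′) (λ y′ → s y y′ * WB.walksFrom s n y′) ⟩
    WA.walksFrom r (suc n) x * WB.walksFrom s (suc n) y ∎
    where open ≡-Reasoning

  walksInto-× : ∀ i (W : A × B → ℕ) (U : A → ℕ) (V : B → ℕ) → (∀ x y → W (x , y) ≡ U x * V y) →
    ∀ x y → W.walksInto R W i (x , y) ≡ WA.walksInto r U i x * WB.walksInto s V i y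
  walksInto-× zero    W U V W≡UV x y = W≡UV x y
  walksInto-× (suc i) W U V W≡UV =
    walksInto-× i (W.pushforward R W) (WA.pushforward r U) (WB.pushforward s V) pushforward-×
    where
    pushforward-× : ∀ x y → W.pushforward R W (x , y) ≡ WA.pushforward r U x * WB.pushforward s V y
    pushforward-× x y = begin
      ∑[ z ∈ cartesianProduct as bs ] (W z * R z (x , y))
        ≡⟨ ∑-cartesianProduct as bs _ ⟩
      ∑[ x′ ∈ as ] ∑[ y′ ∈ bs ] (W (x′ , y′) * R (x′ , y′) (x , y))
        ≡⟨ ∑-cong as (λ x′ → ∑-cong bs (λ y′ → trans (cong₂ _*_ (W≡UV x′ y′) (R≡r*s x′ y′ x y))
                                                      (*-interchange (U x′) (V y′) _ _))) ⟩
      ∑[ x′ ∈ as ] ∑[ y′ ∈ bs ] (U x′ * r x′ x * (V y′ * s y′ y))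
        ≡⟨ ∑-*-∑ as bs (λ x′ → U x′ * r x′ x) (λ y′ → V y′ * s y′ y) ⟩
      WA.pushforward r U x * WB.pushforward s V y ∎
      where open ≡-Reasoning

module ChainCounts (P : FinPoset) where
  open FinPoset P renaming (_≤_ to _≼_; _<_ to _≺_; _≤?_ to _≼?_; _<?_ to _≺?_)
  open IsDecPartialOrder isDecPartialOrder using ()
    renaming (isPartialOrder to ≼-isPartialOrder; reflexive to ≼-reflexive; trans to ≼-trans; antisym to ≼-antisym)
  open NonStrictToStrict _≡_ _≼_ using () renaming (<-irrefl to ≺-irrefl)

  ≺-trans : ∀ {x y z} → x ≺ y → y ≺ z → x ≺ z
  ≺-trans = NonStrictToStrict.<-trans _≡_ _≼_ ≼-isPartialOrder

  ≺-≼-trans : ∀ {x y z} → x ≺ y → y ≼ z → x ≺ z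
  ≺-≼-trans (x≼y , x≢y) y≼z = ≼-trans x≼y y≼z , λ { refl → x≢y (≼-antisym x≼y y≼z) }

  open Walks elems public

  [<] [≤] : Carrier → Carrier → ℕ
  [<] x y = 𝟙[ x ≺? y ]
  [≤] x y = 𝟙[ x ≼? y ]

  [≤]≡δ+[<] : ∀ x y → [≤] x y ≡ 𝟙[ x ≟ y ] + [<] x y
  [≤]≡δ+[<] x y with x ≼? y | x ≟ y
  ... | yes _   | yes _   = refl
  ... | yes _   | no _    = refl
  ... | no x≰y  | yes x≡y = ⊥-elim (x≰y (≼-reflexive x≡y))
  ... | no _    | no _    = refl

  #elems : ℕ
  #elems = length elems

  one : Carrier → ℕ
  one _ = 1

  ∑-seqs-suc : ∀ n (f : Vec Carrier (suc n) → ℕ) →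
    ∑[ v ∈ seqs (suc n) ] f v ≡ ∑[ y ∈ elems ] ∑[ w ∈ seqs n ] f (y ∷ w)
  ∑-seqs-suc n f = trans (∑-concatMap (λ y → map (y ∷_) (seqs n)) elems f)
                         (∑-cong elems (λ y → ∑-map (y ∷_) (seqs n) f))

  𝟙-increasing-∷ : ∀ {n} x y (w : Vec Carrier n) → 𝟙 (increasing (x ∷ y ∷ w)) ≡ [<] x y * 𝟙 (increasing (y ∷ w))
  𝟙-increasing-∷ x y w = 𝟙-∧ (does (x ≺? y)) (increasing (y ∷ w))

  ∑-increasing≡walksFrom : ∀ n x → ∑[ v ∈ seqs n ] 𝟙 (increasing (x ∷ v)) ≡ walksFrom [<] n x
  ∑-increasing≡walksFrom zero    x = refl
  ∑-increasing≡walksFrom (suc n) x = begin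
    ∑[ v ∈ seqs (suc n) ] 𝟙 (increasing (x ∷ v))
      ≡⟨ ∑-seqs-suc n (λ v → 𝟙 (increasing (x ∷ v))) ⟩
    ∑[ y ∈ elems ] ∑[ w ∈ seqs n ] 𝟙 (increasing (x ∷ y ∷ w))
      ≡⟨ ∑-cong elems (λ y → begin
           ∑[ w ∈ seqs n ] 𝟙 (increasing (x ∷ y ∷ w))         ≡⟨ ∑-cong (seqs n) (𝟙-increasing-∷ x y) ⟩
           ∑[ w ∈ seqs n ] ([<] x y * 𝟙 (increasing (y ∷ w)))  ≡⟨ sym (*-distribˡ-∑ ([<] x y) (seqs n) _) ⟩
           [<] x y * ∑[ w ∈ seqs n ] 𝟙 (increasing (y ∷ w))    ≡⟨ cong ([<] x y *_) (∑-increasing≡walksFrom n y) ⟩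
           [<] x y * walksFrom [<] n y                         ∎) ⟩
    walksFrom [<] (suc n) x ∎
    where open ≡-Reasoning

  ∑-chains : ∀ k (f : Vec Carrier (suc k) → ℕ) →
    ∑[ c ∈ chains k ] f c ≡ ∑[ x ∈ elems ] ∑[ v ∈ seqs k ] (𝟙 (increasing (x ∷ v)) * f (x ∷ v))
  ∑-chains k f = begin
    ∑[ c ∈ chains k ] f c
      ≡⟨ ∑-filter (λ c → increasing c Bool.≟ true) (seqs (suc k)) f ⟩
    ∑[ c ∈ seqs (suc k) ] (𝟙[ increasing c Bool.≟ true ] * f c)
      ≡⟨ ∑-cong (seqs (suc k)) (λ c → cong (_* f c) (𝟙[≟true] (increasing c))) ⟩
    ∑[ c ∈ seqs (suc k) ] (𝟙 (increasing c) * f c)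
      ≡⟨ ∑-seqs-suc k (λ c → 𝟙 (increasing c) * f c) ⟩
    ∑[ x ∈ elems ] ∑[ v ∈ seqs k ] (𝟙 (increasing (x ∷ v)) * f (x ∷ v)) ∎
    where open ≡-Reasoning

  #chains≡∑walksFrom : ∀ k → #chains k ≡ ∑[ x ∈ elems ] walksFrom [<] k x
  #chains≡∑walksFrom k = begin
    #chains k                    ≡⟨ length≡∑1 (chains k) ⟩
    ∑[ c ∈ chains k ] 1          ≡⟨ ∑-chains k (λ _ → 1) ⟩
    ∑[ x ∈ elems ] ∑[ v ∈ seqs k ] (𝟙 (increasing (x ∷ v)) * 1)
      ≡⟨ ∑-cong elems (λ x → trans (∑-cong (seqs k) (λ v → *-identityʳ _)) (∑-increasing≡walksFrom k x)) ⟩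
    ∑[ x ∈ elems ] walksFrom [<] k x ∎
    where open ≡-Reasoning

  _∋_ : ∀ {n} → Vec Carrier n → Carrier → ℕ
  v ∋ p = 𝟙[ any? (p ≟_) (toList v) ]

  chainsFromThrough : ℕ → Carrier → Carrier → ℕ
  chainsFromThrough n x p = ∑[ v ∈ seqs n ] (𝟙 (increasing (x ∷ v)) * ((x ∷ v) ∋ p))

  chainsFromThrough-zero : ∀ x p → chainsFromThrough 0 x p ≡ 𝟙[ p ≟ x ]
  chainsFromThrough-zero x p with p ≟ x
  ... | yes _ = refl
  ... | no  _ = refl

  private
    𝟙-∨-split : ∀ a b c → 𝟙 a * 𝟙 (b ∨ c) ≡ 𝟙 b * 𝟙 a + 𝟙 (not b) * (𝟙 a * 𝟙 c)
    𝟙-∨-split true  true  c     = refl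
    𝟙-∨-split true  false true  = refl
    𝟙-∨-split true  false false = refl
    𝟙-∨-split false true  c     = refl
    𝟙-∨-split false false c     = refl

  chainsFromThrough-suc-guarded : ∀ n x p → chainsFromThrough (suc n) x p ≡
    𝟙[ p ≟ x ] * walksFrom [<] (suc n) x + 𝟙 (not (does (p ≟ x))) * ∑[ y ∈ elems ] ([<] x y * chainsFromThrough n y p)
  chainsFromThrough-suc-guarded n x p = begin
    ∑[ v ∈ seqs (suc n) ] (inc v * 𝟙 (does (p ≟ x) ∨ does (any? (p ≟_) (toList v))))
      ≡⟨ ∑-cong (seqs (suc n)) (λ v → 𝟙-∨-split (increasing (x ∷ v)) (does (p ≟ x)) _) ⟩
    ∑[ v ∈ seqs (suc n) ] (𝟙[ p ≟ x ] * inc v + p≢x * (inc v * (v ∋ p)))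
      ≡⟨ ∑-distrib-+ (seqs (suc n)) (λ v → 𝟙[ p ≟ x ] * inc v) (λ v → p≢x * (inc v * (v ∋ p))) ⟩
    ∑[ v ∈ seqs (suc n) ] (𝟙[ p ≟ x ] * inc v) + ∑[ v ∈ seqs (suc n) ] (p≢x * (inc v * (v ∋ p)))
      ≡⟨ cong₂ _+_ (trans (sym (*-distribˡ-∑ 𝟙[ p ≟ x ] (seqs (suc n)) inc))
                          (cong (𝟙[ p ≟ x ] *_) (∑-increasing≡walksFrom (suc n) x)))
                   (trans (sym (*-distribˡ-∑ p≢x (seqs (suc n)) (λ v → inc v * (v ∋ p))))
                          (cong (p≢x *_) tail)) ⟩
    𝟙[ p ≟ x ] * walksFrom [<] (suc n) x + p≢x * ∑[ y ∈ elems ] ([<] x y * chainsFromThrough n y p) ∎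
    where
    open ≡-Reasoning
    inc : Vec Carrier (suc n) → ℕ
    inc v = 𝟙 (increasing (x ∷ v))
    p≢x = 𝟙 (not (does (p ≟ x)))
    tail : ∑[ v ∈ seqs (suc n) ] (inc v * (v ∋ p)) ≡ ∑[ y ∈ elems ] ([<] x y * chainsFromThrough n y p)
    tail = trans (∑-seqs-suc n (λ v → inc v * (v ∋ p))) (∑-cong elems (λ y → begin
      ∑[ w ∈ seqs n ] (inc (y ∷ w) * ((y ∷ w) ∋ p))
        ≡⟨ ∑-cong (seqs n) (λ w → trans (cong (_* ((y ∷ w) ∋ p)) (𝟙-increasing-∷ x y w)) (*-assoc ([<] x y) _ _)) ⟩
      ∑[ w ∈ seqs n ] ([<] x y * (𝟙 (increasing (y ∷ w)) * ((y ∷ w) ∋ p)))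
        ≡⟨ sym (*-distribˡ-∑ ([<] x y) (seqs n) _) ⟩
      [<] x y * chainsFromThrough n y p ∎))

  chainsFromThrough-above : ∀ n {y p} → p ≺ y → chainsFromThrough n y p ≡ 0
  chainsFromThrough-above zero    {y} {p} p≺y =
    trans (chainsFromThrough-zero y p) (𝟙[no] (p ≟ y) (λ p≡y → ≺-irrefl p≡y p≺y))
  chainsFromThrough-above (suc n) {y} {p} p≺y = begin
    chainsFromThrough (suc n) y p
      ≡⟨ chainsFromThrough-suc-guarded n y p ⟩
    𝟙[ p ≟ y ] * walksFrom [<] (suc n) y + 𝟙 (not (does (p ≟ y))) * ∑[ z ∈ elems ] ([<] y z * chainsFromThrough n z p)
      ≡⟨ cong₂ (λ a b → a * walksFrom [<] (suc n) y + 𝟙 (not (does (p ≟ y))) * b)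
               (𝟙[no] (p ≟ y) (λ p≡y → ≺-irrefl p≡y p≺y)) (∑-zero elems (λ z → above z (y ≺? z))) ⟩
    𝟙 (not (does (p ≟ y))) * 0
      ≡⟨ *-zeroʳ (𝟙 (not (does (p ≟ y)))) ⟩
    0 ∎
    where
    open ≡-Reasoning
    above : ∀ z (d : Dec (y ≺ z)) → 𝟙[ d ] * chainsFromThrough n z p ≡ 0
    above z (yes y≺z) = trans (+-identityʳ _) (chainsFromThrough-above n (≺-trans p≺y y≺z))
    above z (no _)    = refl

  chainsFromThrough-suc : ∀ n x p → chainsFromThrough (suc n) x p ≡
    𝟙[ p ≟ x ] * walksFrom [<] (suc n) x + ∑[ y ∈ elems ] ([<] x y * chainsFromThrough n y p)
  chainsFromThrough-suc n x p =
    trans (chainsFromThrough-suc-guarded n x p) (cong (𝟙[ p ≟ x ] * walksFrom [<] (suc n) x +_) (drop-guard (p ≟ x)))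
    where
    -- Chains starting at x = p never return to p.
    drop-guard : (d : Dec (p ≡ x)) → 𝟙 (not (does d)) * ∑[ y ∈ elems ] ([<] x y * chainsFromThrough n y p)
                                    ≡ ∑[ y ∈ elems ] ([<] x y * chainsFromThrough n y p)
    drop-guard (no _)     = +-identityʳ _
    drop-guard (yes refl) = sym (∑-zero elems λ y → go y (x ≺? y))
      where go : ∀ y (d : Dec (x ≺ y)) → 𝟙[ d ] * chainsFromThrough n y x ≡ 0
            go y (yes x≺y) = trans (+-identityʳ _) (chainsFromThrough-above n x≺y)
            go y (no _)    = refl

  ∑-chainsFromThrough : ∀ n p (U : Carrier → ℕ) →
    ∑[ x ∈ elems ] (U x * chainsFromThrough n x p) ≡ ∑[ i + l ≡ n ] (walksInto [<] U i p * walksFrom [<] l p)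
  ∑-chainsFromThrough zero    p U = begin
    ∑[ x ∈ elems ] (U x * chainsFromThrough 0 x p)
      ≡⟨ ∑-cong elems (λ x → trans (cong (U x *_) (chainsFromThrough-zero x p)) (*-comm (U x) _)) ⟩
    ∑[ x ∈ elems ] (𝟙[ p ≟ x ] * U x)
      ≡⟨ δ-sumˡ _≟_ complete unique p U ⟩
    U p
      ≡⟨ sym (*-identityʳ (U p)) ⟩
    U p * 1 ∎
    where open ≡-Reasoning
  ∑-chainsFromThrough (suc n) p U = begin
    ∑[ x ∈ elems ] (U x * chainsFromThrough (suc n) x p)
      ≡⟨ ∑-cong elems (λ x → trans (cong (U x *_) (chainsFromThrough-suc n x p)) (*-distribˡ-+ (U x) _ _)) ⟩
    ∑[ x ∈ elems ] (U x * (𝟙[ p ≟ x ] * W x) + U x * ∑[ y ∈ elems ] ([<] x y * chainsFromThrough n y p))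
      ≡⟨ ∑-distrib-+ elems _ _ ⟩
    ∑[ x ∈ elems ] (U x * (𝟙[ p ≟ x ] * W x)) +
    ∑[ x ∈ elems ] (U x * ∑[ y ∈ elems ] ([<] x y * chainsFromThrough n y p))
      ≡⟨ cong₂ _+_ head tail ⟩
    U p * W p + ∑[ i + l ≡ n ] (walksInto [<] (pushforward [<] U) i p * walksFrom [<] l p) ∎
    where
    open ≡-Reasoning
    W = walksFrom [<] (suc n)
    head : ∑[ x ∈ elems ] (U x * (𝟙[ p ≟ x ] * W x)) ≡ U p * W p
    head = trans (∑-cong elems (λ x → x*[y*z]≡y*[x*z] (U x) 𝟙[ p ≟ x ] (W x)))
                 (δ-sumˡ _≟_ complete unique p (λ x → U x * W x))
    tail : ∑[ x ∈ elems ] (U x * ∑[ y ∈ elems ] ([<] x y * chainsFromThrough n y p)) ≡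
           ∑[ i + l ≡ n ] (walksInto [<] (pushforward [<] U) i p * walksFrom [<] l p)
    tail = begin
      ∑[ x ∈ elems ] (U x * ∑[ y ∈ elems ] ([<] x y * chainsFromThrough n y p))
        ≡⟨ ∑-cong elems (λ x → trans (*-distribˡ-∑ (U x) elems _) (∑-cong elems (λ y → sym (*-assoc (U x) _ _)))) ⟩
      ∑[ x ∈ elems ] ∑[ y ∈ elems ] (U x * [<] x y * chainsFromThrough n y p)
        ≡⟨ ∑-comm elems elems _ ⟩
      ∑[ y ∈ elems ] ∑[ x ∈ elems ] (U x * [<] x y * chainsFromThrough n y p)
        ≡⟨ ∑-cong elems (λ y → sym (*-distribʳ-∑ (chainsFromThrough n y p) elems (λ x → U x * [<] x y))) ⟩
      ∑[ y ∈ elems ] (pushforward [<] U y * chainsFromThrough n y p)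
        ≡⟨ ∑-chainsFromThrough n p (pushforward [<] U) ⟩
      ∑[ i + l ≡ n ] (walksInto [<] (pushforward [<] U) i p * walksFrom [<] l p) ∎

  #chainsThrough≡∑antidiagonal : ∀ k p →
    #chainsThrough k p ≡ ∑[ i + l ≡ k ] (walksInto [<] one i p * walksFrom [<] l p)
  #chainsThrough≡∑antidiagonal k p = begin
    #chainsThrough k p
      ≡⟨ length-filter≡∑𝟙 (λ c → any? (p ≟_) (toList c)) (chains k) ⟩
    ∑[ c ∈ chains k ] (c ∋ p)
      ≡⟨ ∑-chains k (_∋ p) ⟩
    ∑[ x ∈ elems ] chainsFromThrough k x p
      ≡⟨ ∑-cong elems (λ x → sym (+-identityʳ _)) ⟩
    ∑[ x ∈ elems ] (one x * chainsFromThrough k x p)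
      ≡⟨ ∑-chainsFromThrough k p one ⟩
    ∑[ i + l ≡ k ] (walksInto [<] one i p * walksFrom [<] l p) ∎
    where open ≡-Reasoning

  #chainsThrough≤#chains : ∀ k p → #chainsThrough k p ≤ #chains k
  #chainsThrough≤#chains k p = length-filter (λ c → any? (p ≟_) (toList c)) (chains k)

  #multichains : ℕ → ℕ
  #multichains m = ∑[ x ∈ elems ] walksFrom [≤] m x

  -- Counts multichains with multiplicity: once for every position at which p occurs.
  #multichainsThrough : ℕ → Carrier → ℕ
  #multichainsThrough m p = ∑[ i + l ≡ m ] (walksInto [≤] one i p * walksFrom [≤] l p)

  #multichains≡binomialTransform : ∀ m → #multichains m ≡ binomialTransform m #chains
  #multichains≡binomialTransform m = begin
    ∑[ x ∈ elems ] walksFrom [≤] m x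
      ≡⟨ ∑-cong elems (walksFrom-δ+ _≟_ complete unique [<] [≤] [≤]≡δ+[<] m) ⟩
    ∑[ x ∈ elems ] binomialTransform m (λ s → walksFrom [<] s x)
      ≡⟨ ∑-binomialTransform-comm elems m (λ x s → walksFrom [<] s x) ⟩
    binomialTransform m (λ s → ∑[ x ∈ elems ] walksFrom [<] s x)
      ≡⟨ binomialTransform-cong m (λ s → sym (#chains≡∑walksFrom s)) ⟩
    binomialTransform m #chains ∎
    where open ≡-Reasoning

  #multichainsThrough≡binomialTransform : ∀ m p →
    #multichainsThrough m p ≡ binomialTransform (suc m) (shift (λ k → #chainsThrough k p))
  #multichainsThrough≡binomialTransform m p = begin
    ∑[ i + l ≡ m ] (walksInto [≤] one i p * walksFrom [≤] l p)
      ≡⟨ ∑antidiagonal-cong m (λ i l _ → cong₂ _*_ (walksInto-δ+ _≟_ complete unique [<] [≤] [≤]≡δ+[<] i one p)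
                                                  (walksFrom-δ+ _≟_ complete unique [<] [≤] [≤]≡δ+[<] l p)) ⟩
    ∑[ i + l ≡ m ] (binomialTransform i α * binomialTransform l β)
      ≡⟨ ∑antidiagonal-binomialTransform m α β ⟩
    binomialTransform (suc m) (shift (λ k → convolution k α β))
      ≡⟨ binomialTransform-cong (suc m) {shift (λ k → convolution k α β)} {shift (λ k → #chainsThrough k p)}
           (λ { zero → refl ; (suc k) → sym (#chainsThrough≡∑antidiagonal k p) }) ⟩
    binomialTransform (suc m) (shift (λ k → #chainsThrough k p)) ∎
    where
    open ≡-Reasoning
    α β : ℕ → ℕ
    α s = walksInto [<] one s p
    β t = walksFrom [<] t p

  ∑𝟙[≟]≡1 : ∀ x → ∑[ z ∈ elems ] 𝟙[ x ≟ z ] ≡ 1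
  ∑𝟙[≟]≡1 x = trans (∑-cong elems (λ z → sym (*-identityʳ 𝟙[ x ≟ z ]))) (δ-sumˡ _≟_ complete unique x one)

  strictlyAbove : Carrier → ℕ
  strictlyAbove x = ∑[ z ∈ elems ] [<] x z

  ∑[≤]≡1+strictlyAbove : ∀ x → ∑[ z ∈ elems ] [≤] x z ≡ suc (strictlyAbove x)
  ∑[≤]≡1+strictlyAbove x = begin
    ∑[ z ∈ elems ] [≤] x z
      ≡⟨ ∑-cong elems ([≤]≡δ+[<] x) ⟩
    ∑[ z ∈ elems ] (𝟙[ x ≟ z ] + [<] x z)
      ≡⟨ ∑-distrib-+ elems (λ z → 𝟙[ x ≟ z ]) ([<] x) ⟩
    ∑[ z ∈ elems ] 𝟙[ x ≟ z ] + strictlyAbove x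
      ≡⟨ cong (_+ strictlyAbove x) (∑𝟙[≟]≡1 x) ⟩
    suc (strictlyAbove x) ∎
    where open ≡-Reasoning

  strictlyAbove<#elems : ∀ x → strictlyAbove x < #elems
  strictlyAbove<#elems x = begin-strict
    strictlyAbove x             <⟨ n<1+n (strictlyAbove x) ⟩
    suc (strictlyAbove x)       ≡⟨ sym (∑[≤]≡1+strictlyAbove x) ⟩
    ∑[ z ∈ elems ] [≤] x z      ≤⟨ ∑-mono-≤ elems (λ z → 𝟙[]≤1 (x ≼? z)) ⟩
    ∑[ z ∈ elems ] 1            ≡⟨ sym (length≡∑1 elems) ⟩
    #elems                      ∎
    where open ≤-Reasoning

  strictlyAbove-< : ∀ {x y} → x ≺ y → strictlyAbove y < strictlyAbove x
  strictlyAbove-< {x} {y} x≺y = begin-strict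
    strictlyAbove y             <⟨ n<1+n (strictlyAbove y) ⟩
    suc (strictlyAbove y)       ≡⟨ sym (∑[≤]≡1+strictlyAbove y) ⟩
    ∑[ z ∈ elems ] [≤] y z      ≤⟨ ∑-mono-≤ elems (λ z → 𝟙[]-mono (y ≼? z) (x ≺? z) (≺-≼-trans x≺y)) ⟩
    strictlyAbove x             ∎
    where open ≤-Reasoning

  walksFrom≢0⇒≤strictlyAbove : ∀ k x → walksFrom [<] k x ≢ 0 → k ≤ strictlyAbove x
  walksFrom≢0⇒≤strictlyAbove zero    x _  = z≤n
  walksFrom≢0⇒≤strictlyAbove (suc k) x ≢0 with ∑≢0⇒∃≢0 elems (λ y → [<] x y * walksFrom [<] k y) ≢0
  ... | y , term≢0 = ≤-trans (s≤s (walksFrom≢0⇒≤strictlyAbove k y walks≢0)) (strictlyAbove-< x≺y)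
    where
    walks≢0 : walksFrom [<] k y ≢ 0
    walks≢0 w≡0 = term≢0 (trans (cong ([<] x y *_) w≡0) (*-zeroʳ ([<] x y)))
    x≺y : x ≺ y
    x≺y = 𝟙[]≢0⇒ (x ≺? y) (λ 𝟙≡0 → term≢0 (cong (_* walksFrom [<] k y) 𝟙≡0))

  #chains≢0⇒<#elems : ∀ k → #chains k ≢ 0 → k < #elems
  #chains≢0⇒<#elems k ≢0 with ∑≢0⇒∃≢0 elems (walksFrom [<] k) (≢0 ∘ trans (#chains≡∑walksFrom k))
  ... | x , walks≢0 = ≤-<-trans (walksFrom≢0⇒≤strictlyAbove k x walks≢0) (strictlyAbove<#elems x)

  #chains-suc-≤ : ∀ k → #chains (suc k) ≤ #elems * #chains k
  #chains-suc-≤ k = begin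
    #chains (suc k)                                        ≡⟨ #chains≡∑walksFrom (suc k) ⟩
    ∑[ x ∈ elems ] ∑[ y ∈ elems ] ([<] x y * walksFrom [<] k y)
      ≤⟨ ∑-mono-≤ elems (λ x → ∑-mono-≤ elems (λ y → *-monoˡ-≤ (walksFrom [<] k y) (𝟙[]≤1 (x ≺? y)))) ⟩
    ∑[ x ∈ elems ] ∑[ y ∈ elems ] (1 * walksFrom [<] k y)  ≡⟨ ∑-*-∑ elems elems one (walksFrom [<] k) ⟩
    ∑[ x ∈ elems ] 1 * ∑[ y ∈ elems ] walksFrom [<] k y
      ≡⟨ cong₂ _*_ (sym (length≡∑1 elems)) (sym (#chains≡∑walksFrom k)) ⟩
    #elems * #chains k                                     ∎
    where open ≤-Reasoning

  #chains-suc≡0 : ∀ k → #chains k ≡ 0 → #chains (suc k) ≡ 0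
  #chains-suc≡0 k ≡0 =
    n≤0⇒n≡0 (subst (#chains (suc k) ≤_) (trans (cong (#elems *_) ≡0) (*-zeroʳ #elems)) (#chains-suc-≤ k))

  #chains≢0-antitone : ∀ {k j} → k ≤ j → #chains j ≢ 0 → #chains k ≢ 0
  #chains≢0-antitone k≤j = go (≤⇒≤′ k≤j)
    where
    go : ∀ {k j} → k ≤′ j → #chains j ≢ 0 → #chains k ≢ 0
    go ≤′-refl                    ≢0 = ≢0
    go {j = suc j} (≤′-step k≤′j) ≢0 = go k≤′j (≢0 ∘ #chains-suc≡0 j)

  #chains-zero : #chains 0 ≡ #elems
  #chains-zero = trans (#chains≡∑walksFrom 0) (sym (length≡∑1 elems))

  #chains≢0⇒≤rank : ∀ k → #chains k ≢ 0 → k ≤ rank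
  #chains≢0⇒≤rank k ≢0 = foldr-preservesᵒ ≤-⊔ 0 _ (inj₂ (Any.map ≤-reflexive
    (∈-filter⁺ (λ j → 1 ≤? #chains j) (∈-upTo⁺ (#chains≢0⇒<#elems k ≢0)) (n≢0⇒n>0 ≢0))))
    where
    ≤-⊔ : ∀ x y → k ≤ x ⊎ k ≤ y → k ≤ x ⊔ y
    ≤-⊔ x y (inj₁ k≤x) = ≤-trans k≤x (m≤m⊔n x y)
    ≤-⊔ x y (inj₂ k≤y) = ≤-trans k≤y (m≤n⊔m x y)

  rank≡0⊎#chains[rank]≢0 : rank ≡ 0 ⊎ #chains rank ≢ 0
  rank≡0⊎#chains[rank]≢0 = foldr-preservesᵇ {P = λ j → j ≡ 0 ⊎ #chains j ≢ 0} ⊔-pres (inj₁ refl)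
    (All.map (λ 1≤ → inj₂ (λ ≡0 → 1+n≰n (subst (1 ≤_) ≡0 1≤)))
             (all-filter (λ j → 1 ≤? #chains j) (upTo #elems)))
    where
    ⊔-pres : ∀ {x y} → (x ≡ 0 ⊎ #chains x ≢ 0) → (y ≡ 0 ⊎ #chains y ≢ 0) →
             (x ⊔ y ≡ 0 ⊎ #chains (x ⊔ y) ≢ 0)
    ⊔-pres {x} {y} px py with ⊔-sel x y
    ... | inj₁ x⊔y≡x rewrite x⊔y≡x = px
    ... | inj₂ x⊔y≡y rewrite x⊔y≡y = py

  ≤rank⇒#chains≢0 : ∀ k → k ≤ rank → #elems ≢ 0 → #chains k ≢ 0
  ≤rank⇒#chains≢0 k k≤rank N≢0 with rank≡0⊎#chains[rank]≢0
  ... | inj₁ rank≡0 = #chains≢0-antitone (subst (k ≤_) rank≡0 k≤rank) (N≢0 ∘ trans (sym #chains-zero))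
  ... | inj₂ ≢0     = #chains≢0-antitone k≤rank ≢0

  ∑-walksInto-walksFrom≡#multichains : ∀ i l →
    ∑[ q ∈ elems ] (walksInto [≤] one i q * walksFrom [≤] l q) ≡ #multichains (i + l)
  ∑-walksInto-walksFrom≡#multichains i l =
    trans (∑-walksInto-walksFrom [≤] i l one) (∑-cong elems (λ q → +-identityʳ _))

  ∑-*-#multichainsThrough : ∀ m (f : Carrier → ℕ) →
    ∑[ p ∈ elems ] (f p * #multichainsThrough m p) ≡
    ∑[ i + l ≡ m ] ∑[ p ∈ elems ] (f p * (walksInto [≤] one i p * walksFrom [≤] l p))
  ∑-*-#multichainsThrough m f =
    trans (∑-cong elems (λ p → *-distribˡ-∑antidiagonal (f p) m _)) (∑-∑antidiagonal-comm elems m _)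

  _⋖_ : Carrier → Carrier → Set
  x ⋖ p = x ≺ p × (∀ z → ¬ (x ≺ z × z ≺ p))

  _⋖?_ : ∀ x p → Dec (x ⋖ p)
  x ⋖? p = map′ (λ (x≺p , none) → x≺p , λ z → All.lookup none (complete z))
                (λ (x≺p , none) → x≺p , All.tabulate (λ {z} _ → none z))
                ((x ≺? p) ×-dec all? (λ z → ¬? ((x ≺? z) ×-dec (z ≺? p))) elems)

  ddeg≡∑𝟙⋖ : ∀ p → ddeg p ≡ ∑[ x ∈ elems ] 𝟙[ x ⋖? p ]
  ddeg≡∑𝟙⋖ p = trans (length-filter≡∑𝟙 (λ x → covers p x Bool.≟ true) elems)
                      (∑-cong elems (λ x → 𝟙[≟true] (covers p x)))

module _ where
  open import Data.Integer as ℤ using (+_)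
  import Data.Integer.Properties as ℤ
  open import Data.Rational.Unnormalised as ℚᵘ using (mkℚᵘ; *≡*) renaming (_≃_ to _≃ᵘ_)
  import Data.Rational.Unnormalised.Properties as ℚᵘ

  module _ where
    open import Data.Integer as ℤ using (+_)
    import Data.Integer.Properties as ℤ
    open import Data.Rational.Unnormalised as ℚᵘ using (mkℚᵘ; *≡*) renaming (_≃_ to _≃ᵘ_)
    import Data.Rational.Unnormalised.Properties as ℚᵘ

    private
      -- n ÷ suc d is by definition  fromℚᵘ (mkℚᵘ (+ n) d).
      toℚᵘ-÷ : ∀ n d → ℚ.toℚᵘ (n ÷ suc d) ≃ᵘ mkℚᵘ (+ n) d
      toℚᵘ-÷ n d = ℚ.toℚᵘ-fromℚᵘ (mkℚᵘ (+ n) d)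

      mkℚᵘ-cong : ∀ {m n c d} → m * suc d ≡ n * suc c → mkℚᵘ (+ m) c ≃ᵘ mkℚᵘ (+ n) d
      mkℚᵘ-cong {m} {n} {c} {d} eq = *≡* (trans (sym (ℤ.pos-* m (suc d))) (trans (cong +_ eq) (ℤ.pos-* n (suc c))))

      mkℚᵘ-+ : ∀ a b d → mkℚᵘ (+ a) d ℚᵘ.+ mkℚᵘ (+ b) d ≃ᵘ mkℚᵘ (+ (a + b)) d
      mkℚᵘ-+ a b d = *≡* (begin
        (+ a ℤ.* + suc d ℤ.+ + b ℤ.* + suc d) ℤ.* + suc d
          ≡⟨ cong (ℤ._* + suc d) (cong₂ ℤ._+_ (sym (ℤ.pos-* a (suc d))) (sym (ℤ.pos-* b (suc d)))) ⟩
        (+ (a * suc d) ℤ.+ + (b * suc d)) ℤ.* + suc d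
          ≡⟨ cong (ℤ._* + suc d) (sym (ℤ.pos-+ (a * suc d) (b * suc d))) ⟩
        + (a * suc d + b * suc d) ℤ.* + suc d
          ≡⟨ sym (ℤ.pos-* (a * suc d + b * suc d) (suc d)) ⟩
        + ((a * suc d + b * suc d) * suc d)
          ≡⟨ cong +_ (lemma a b (suc d)) ⟩
        + ((a + b) * (suc d * suc d))
          ≡⟨ ℤ.pos-* (a + b) (suc d * suc d) ⟩
        + (a + b) ℤ.* + (suc d * suc d) ∎)
        where
        open ≡-Reasoning
        lemma : ∀ a b e → (a * e + b * e) * e ≡ (a + b) * (e * e)
        lemma = solve-∀

      mkℚᵘ-* : ∀ a b d → mkℚᵘ (+ a) 0 ℚᵘ.* mkℚᵘ (+ b) d ≃ᵘ mkℚᵘ (+ (a * b)) d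
      mkℚᵘ-* a b d = *≡* (trans (cong (ℤ._* + suc d) (sym (ℤ.pos-* a b)))
                                (cong (λ e → + (a * b) ℤ.* + e) (sym (*-identityˡ (suc d)))))

    module _ where
      open import Relation.Binary.Reasoning.Setoid ℚᵘ.≃-setoid

      ÷-+ : ∀ a b d → a ÷ suc d ℚ.+ b ÷ suc d ≡ (a + b) ÷ suc d
      ÷-+ a b d = ℚ.toℚᵘ-injective (begin
        ℚ.toℚᵘ (a ÷ suc d ℚ.+ b ÷ suc d)              ≈⟨ ℚ.toℚᵘ-homo-+ (a ÷ suc d) (b ÷ suc d) ⟩
        ℚ.toℚᵘ (a ÷ suc d) ℚᵘ.+ ℚ.toℚᵘ (b ÷ suc d)    ≈⟨ ℚᵘ.+-cong (toℚᵘ-÷ a d) (toℚᵘ-÷ b d) ⟩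
        mkℚᵘ (+ a) d ℚᵘ.+ mkℚᵘ (+ b) d                ≈⟨ mkℚᵘ-+ a b d ⟩
        mkℚᵘ (+ (a + b)) d                            ≈⟨ toℚᵘ-÷ (a + b) d ⟨
        ℚ.toℚᵘ ((a + b) ÷ suc d)                      ∎)

      ÷-* : ∀ a b d → a ÷ 1 ℚ.* b ÷ suc d ≡ (a * b) ÷ suc d
      ÷-* a b d = ℚ.toℚᵘ-injective (begin
        ℚ.toℚᵘ (a ÷ 1 ℚ.* b ÷ suc d)                  ≈⟨ ℚ.toℚᵘ-homo-* (a ÷ 1) (b ÷ suc d) ⟩
        ℚ.toℚᵘ (a ÷ 1) ℚᵘ.* ℚ.toℚᵘ (b ÷ suc d)        ≈⟨ ℚᵘ.*-cong (toℚᵘ-÷ a 0) (toℚᵘ-÷ b d) ⟩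
        mkℚᵘ (+ a) 0 ℚᵘ.* mkℚᵘ (+ b) d                ≈⟨ mkℚᵘ-* a b d ⟩
        mkℚᵘ (+ (a * b)) d                            ≈⟨ toℚᵘ-÷ (a * b) d ⟨
        ℚ.toℚᵘ ((a * b) ÷ suc d)                      ∎)

      0÷ : ∀ d → 0 ÷ d ≡ 0ℚ
      0÷ zero    = refl
      0÷ (suc d) = ℚ.toℚᵘ-injective (begin
        ℚ.toℚᵘ (0 ÷ suc d)   ≈⟨ toℚᵘ-÷ 0 d ⟩
        mkℚᵘ (+ 0) d         ≈⟨ *≡* refl ⟩
        ℚ.toℚᵘ 0ℚ            ∎)

    sumℚ-÷ : ∀ {A : Set} (xs : List A) (f g : A → ℕ) d →
      sumℚ (map (λ x → f x ÷ 1 ℚ.* g x ÷ d) xs) ≡ (∑[ x ∈ xs ] (f x * g x)) ÷ d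
    sumℚ-÷ []       f g d       = sym (0÷ d)
    sumℚ-÷ (x ∷ xs) f g zero    = trans (cong₂ ℚ._+_ (ℚ.*-zeroʳ (f x ÷ 1)) (sumℚ-÷ xs f g zero)) (ℚ.+-identityʳ 0ℚ)
    sumℚ-÷ (x ∷ xs) f g (suc d) =
      trans (cong₂ ℚ._+_ (÷-* (f x) (g x) d) (sumℚ-÷ xs f g (suc d))) (÷-+ (f x * g x) _ d)

    sumℚ-[] : ∀ {A : Set} (xs : List A) (h : A → ℚ) → length xs ≡ 0 → sumℚ (map h xs) ≡ 0ℚ
    sumℚ-[] [] h _ = refl

    ÷≡÷⇒*≡* : ∀ a b c d → c ≢ 0 → d ≢ 0 → a ÷ c ≡ b ÷ d → a * d ≡ b * c
    ÷≡÷⇒*≡* a b zero    d       c≢0 _   _  = ⊥-elim (c≢0 refl)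
    ÷≡÷⇒*≡* a b (suc c) zero    _   d≢0 _  = ⊥-elim (d≢0 refl)
    ÷≡÷⇒*≡* a b (suc c) (suc d) _   _   eq = ℚ.normalize-injective-≃ a b (suc c) (suc d) eq

    *≡*⇒÷≡÷ : ∀ a b c d → c ≢ 0 → d ≢ 0 → a * d ≡ b * c → a ÷ c ≡ b ÷ d
    *≡*⇒÷≡÷ a b zero    d       c≢0 _   _  = ⊥-elim (c≢0 refl)
    *≡*⇒÷≡÷ a b (suc c) zero    _   d≢0 _  = ⊥-elim (d≢0 refl)
    *≡*⇒÷≡÷ a b (suc c) (suc d) _   _   eq = ℚ.fromℚᵘ-cong {mkℚᵘ (+ a) c} {mkℚᵘ (+ b) d} (mkℚᵘ-cong eq)

module Identities (P : FinPoset) where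
  open FinPoset P using (Carrier; elems; ddeg; #chains; #chainsThrough)
  open ChainCounts P

  ∑ddeg : ℕ
  ∑ddeg = ∑[ p ∈ elems ] ddeg p

  -- 𝔼(chain(k); ddeg) = 𝔼(uni; ddeg) with the denominators cleared.
  ChainIdentity : ℕ → Set
  ChainIdentity k = #elems * ∑[ p ∈ elems ] (ddeg p * #chainsThrough k p) ≡ suc k * #chains k * ∑ddeg

  MultichainIdentity : ℕ → Set
  MultichainIdentity m = #elems * ∑[ p ∈ elems ] (ddeg p * #multichainsThrough m p) ≡ suc m * #multichains m * ∑ddeg

  𝔼-chain : ∀ k → 𝔼 P (chainDist P k) ddeg ≡ (∑[ p ∈ elems ] (ddeg p * #chainsThrough k p)) ÷ (suc k * #chains k)
  𝔼-chain k = sumℚ-÷ elems ddeg (λ p → #chainsThrough k p) (suc k * #chains k)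

  𝔼-uni : 𝔼 P (uni P) ddeg ≡ ∑ddeg ÷ #elems
  𝔼-uni = trans (sumℚ-÷ elems ddeg (λ _ → 1) #elems) (cong (_÷ #elems) (∑-cong elems (λ p → *-identityʳ (ddeg p))))

  #chains≡0⇒ChainIdentity : ∀ k → #chains k ≡ 0 → ChainIdentity k
  #chains≡0⇒ChainIdentity k #chains≡0 = begin
    #elems * ∑[ p ∈ elems ] (ddeg p * #chainsThrough k p)   ≡⟨ cong (#elems *_) (∑-zero elems through≡0) ⟩
    #elems * 0                                              ≡⟨ *-zeroʳ #elems ⟩
    0                                                       ≡⟨ cong (_* ∑ddeg) (*-zeroʳ (suc k)) ⟨
    suc k * 0 * ∑ddeg                                       ≡⟨ cong (λ c → suc k * c * ∑ddeg) #chains≡0 ⟨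
    suc k * #chains k * ∑ddeg                               ∎
    where
    open ≡-Reasoning
    through≡0 : ∀ p → ddeg p * #chainsThrough k p ≡ 0
    through≡0 p = trans (cong (ddeg p *_) #chainsThrough≡0)
                        (*-zeroʳ (ddeg p))
      where
      #chainsThrough≡0 : #chainsThrough k p ≡ 0
      #chainsThrough≡0 = n≤0⇒n≡0 (subst (#chainsThrough k p ≤_) #chains≡0 (#chainsThrough≤#chains k p))

  mCDE⇒ChainIdentity : mCDE P → ∀ k → ChainIdentity k
  mCDE⇒ChainIdentity mcde k = split (#chains k ℕ.≟ 0)
    where
    D = ∑[ p ∈ elems ] (ddeg p * #chainsThrough k p)
    split : Dec (#chains k ≡ 0) → ChainIdentity k
    split (yes #chains≡0) = #chains≡0⇒ChainIdentity k #chains≡0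
    split (no #chains≢0)  = begin
      #elems * D                   ≡⟨ *-comm #elems D ⟩
      D * #elems                   ≡⟨ ÷≡÷⇒*≡* D ∑ddeg (suc k * #chains k) #elems
                                        (#chains≢0 ∘ m+n≡0⇒m≡0 (#chains k)) #elems≢0 expectations ⟩
      ∑ddeg * (suc k * #chains k)  ≡⟨ *-comm ∑ddeg (suc k * #chains k) ⟩
      suc k * #chains k * ∑ddeg    ∎
      where
      open ≡-Reasoning
      #elems≢0 = m<n⇒n≢0 (#chains≢0⇒<#elems k #chains≢0)
      expectations : D ÷ (suc k * #chains k) ≡ ∑ddeg ÷ #elems
      expectations = trans (sym (𝔼-chain k)) (trans (mcde k (#chains≢0⇒≤rank k #chains≢0)) 𝔼-uni)

  ChainIdentity⇒mCDE : (∀ k → ChainIdentity k) → mCDE P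
  ChainIdentity⇒mCDE identity k k≤rank = split (#elems ℕ.≟ 0)
    where
    D = ∑[ p ∈ elems ] (ddeg p * #chainsThrough k p)
    split : Dec (#elems ≡ 0) → 𝔼 P (chainDist P k) ddeg ≡ 𝔼 P (uni P) ddeg
    split (yes #elems≡0) = trans (sumℚ-[] elems _ #elems≡0) (sym (sumℚ-[] elems _ #elems≡0))
    split (no #elems≢0)  = begin
      𝔼 P (chainDist P k) ddeg       ≡⟨ 𝔼-chain k ⟩
      D ÷ (suc k * #chains k)        ≡⟨ *≡*⇒÷≡÷ D ∑ddeg (suc k * #chains k) #elems
                                          (#chains≢0 ∘ m+n≡0⇒m≡0 (#chains k)) #elems≢0 cross ⟩
      ∑ddeg ÷ #elems                 ≡⟨ 𝔼-uni ⟨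
      𝔼 P (uni P) ddeg               ∎
      where
      open ≡-Reasoning
      #chains≢0 = ≤rank⇒#chains≢0 k k≤rank #elems≢0
      cross : D * #elems ≡ ∑ddeg * (suc k * #chains k)
      cross = trans (*-comm D #elems) (trans (identity k) (*-comm (suc k * #chains k) ∑ddeg))

  private
    chainIdentityˡ chainIdentityʳ : ℕ → ℕ
    chainIdentityˡ k = #elems * ∑[ p ∈ elems ] (ddeg p * #chainsThrough k p)
    chainIdentityʳ k = suc k * #chains k * ∑ddeg

    multichainIdentityˡ≡binomialTransform : ∀ m →
      #elems * ∑[ p ∈ elems ] (ddeg p * #multichainsThrough m p) ≡ binomialTransform (suc m) (shift chainIdentityˡ)
    multichainIdentityˡ≡binomialTransform m = begin
      #elems * ∑[ p ∈ elems ] (ddeg p * #multichainsThrough m p)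
        ≡⟨ cong (#elems *_) (∑-cong elems through) ⟩
      #elems * ∑[ p ∈ elems ] binomialTransform (suc m) (λ s → ddeg p * thr p s)
        ≡⟨ cong (#elems *_) (∑-binomialTransform-comm elems (suc m) (λ p s → ddeg p * thr p s)) ⟩
      #elems * binomialTransform (suc m) weighted
        ≡⟨ *-distribˡ-binomialTransform #elems (suc m) weighted ⟩
      binomialTransform (suc m) (λ s → #elems * weighted s)
        ≡⟨ binomialTransform-cong (suc m) shifted ⟩
      binomialTransform (suc m) (shift chainIdentityˡ) ∎
      where
      open ≡-Reasoning
      thr : Carrier → ℕ → ℕ
      thr p = shift (λ k → #chainsThrough k p)
      weighted : ℕ → ℕ
      weighted s = ∑[ p ∈ elems ] (ddeg p * thr p s)
      through : ∀ p → ddeg p * #multichainsThrough m p ≡ binomialTransform (suc m) (λ s → ddeg p * thr p s)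
      through p = trans (cong (ddeg p *_) (#multichainsThrough≡binomialTransform m p))
                        (*-distribˡ-binomialTransform (ddeg p) (suc m) (thr p))
      shifted : ∀ s → #elems * weighted s ≡ shift chainIdentityˡ s
      shifted zero    = trans (cong (#elems *_) (∑-zero elems (λ p → *-zeroʳ (ddeg p)))) (*-zeroʳ #elems)
      shifted (suc k) = refl

    multichainIdentityʳ≡binomialTransform : ∀ m →
      suc m * #multichains m * ∑ddeg ≡ binomialTransform (suc m) (shift chainIdentityʳ)
    multichainIdentityʳ≡binomialTransform m = begin
      suc m * #multichains m * ∑ddeg
        ≡⟨ cong (λ c → suc m * c * ∑ddeg) (#multichains≡binomialTransform m) ⟩
      suc m * binomialTransform m #chains * ∑ddeg
        ≡⟨ cong (_* ∑ddeg) (suc-*-binomialTransform m #chains) ⟩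
      binomialTransform (suc m) (shift (λ k → suc k * #chains k)) * ∑ddeg
        ≡⟨ *-distribʳ-binomialTransform ∑ddeg (suc m) (shift (λ k → suc k * #chains k)) ⟩
      binomialTransform (suc m) (λ s → shift (λ k → suc k * #chains k) s * ∑ddeg)
        ≡⟨ binomialTransform-cong (suc m) shifted ⟩
      binomialTransform (suc m) (shift chainIdentityʳ) ∎
      where
      open ≡-Reasoning
      shifted : ∀ s → shift (λ k → suc k * #chains k) s * ∑ddeg ≡ shift chainIdentityʳ s
      shifted zero    = refl
      shifted (suc k) = refl

  ChainIdentity⇒MultichainIdentity : (∀ k → ChainIdentity k) → ∀ m → MultichainIdentity m
  ChainIdentity⇒MultichainIdentity identity m = begin
    #elems * ∑[ p ∈ elems ] (ddeg p * #multichainsThrough m p)  ≡⟨ multichainIdentityˡ≡binomialTransform m ⟩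
    binomialTransform (suc m) (shift chainIdentityˡ)            ≡⟨ binomialTransform-cong (suc m) shift-identity ⟩
    binomialTransform (suc m) (shift chainIdentityʳ)            ≡⟨ multichainIdentityʳ≡binomialTransform m ⟨
    suc m * #multichains m * ∑ddeg                              ∎
    where
    open ≡-Reasoning
    shift-identity : ∀ s → shift chainIdentityˡ s ≡ shift chainIdentityʳ s
    shift-identity zero    = refl
    shift-identity (suc k) = identity k

  MultichainIdentity⇒ChainIdentity : (∀ m → MultichainIdentity m) → ∀ k → ChainIdentity k
  MultichainIdentity⇒ChainIdentity identity k =
    binomialTransform-injective {shift chainIdentityˡ} {shift chainIdentityʳ} transformed (suc k)
    where
    transformed : ∀ n → binomialTransform n (shift chainIdentityˡ) ≡ binomialTransform n (shift chainIdentityʳ)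
    transformed zero    = refl
    transformed (suc m) = trans (sym (multichainIdentityˡ≡binomialTransform m))
                                (trans (identity m) (multichainIdentityʳ≡binomialTransform m))

module Product (P Q : FinPoset) where
  private
    module P   = FinPoset P
    module Q   = FinPoset Q
    module PQ  = FinPoset (P ×P Q)
    module ≼P  = IsDecPartialOrder P.isDecPartialOrder
    module ≼Q  = IsDecPartialOrder Q.isDecPartialOrder
    module CP  = ChainCounts P
    module CQ  = ChainCounts Q
    module CPQ = ChainCounts (P ×P Q)
    module IP  = Identities P
    module IQ  = Identities Q
    module IPQ = Identities (P ×P Q)

  ∑-× : ∀ (f : P.Carrier × Q.Carrier → ℕ) →
        ∑[ z ∈ PQ.elems ] f z ≡ ∑[ x ∈ P.elems ] ∑[ y ∈ Q.elems ] f (x , y)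
  ∑-× = ∑-cartesianProduct P.elems Q.elems

  #elems-× : CPQ.#elems ≡ CP.#elems * CQ.#elems
  #elems-× = begin
    length PQ.elems                                       ≡⟨ length≡∑1 PQ.elems ⟩
    ∑[ z ∈ PQ.elems ] 1                                   ≡⟨ ∑-× (λ _ → 1) ⟩
    ∑[ x ∈ P.elems ] ∑[ y ∈ Q.elems ] (1 * 1)             ≡⟨ ∑-*-∑ P.elems Q.elems CP.one CQ.one ⟩
    ∑[ x ∈ P.elems ] 1 * ∑[ y ∈ Q.elems ] 1
      ≡⟨ cong₂ _*_ (length≡∑1 P.elems) (length≡∑1 Q.elems) ⟨
    length P.elems * length Q.elems                       ∎
    where open ≡-Reasoning

  [≤]-× : ∀ p q x y → CPQ.[≤] (p , q) (x , y) ≡ CP.[≤] p x * CQ.[≤] q y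
  [≤]-× p q x y = 𝟙-∧ (does (p P.≤? x)) (does (q Q.≤? y))

  walksFrom-[≤]-× : ∀ n p q → CPQ.walksFrom CPQ.[≤] n (p , q) ≡ CP.walksFrom CP.[≤] n p * CQ.walksFrom CQ.[≤] n q
  walksFrom-[≤]-× = walksFrom-× P.elems Q.elems CP.[≤] CQ.[≤] CPQ.[≤] [≤]-×

  walksInto-[≤]-× : ∀ i p q →
    CPQ.walksInto CPQ.[≤] CPQ.one i (p , q) ≡ CP.walksInto CP.[≤] CP.one i p * CQ.walksInto CQ.[≤] CQ.one i q
  walksInto-[≤]-× i = walksInto-× P.elems Q.elems CP.[≤] CQ.[≤] CPQ.[≤] [≤]-× i CPQ.one CP.one CQ.one (λ _ _ → refl)

  #multichains-× : ∀ m → CPQ.#multichains m ≡ CP.#multichains m * CQ.#multichains m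
  #multichains-× m = trans (∑-× (CPQ.walksFrom CPQ.[≤] m))
    (trans (∑-cong P.elems (λ x → ∑-cong Q.elems (walksFrom-[≤]-× m x)))
           (∑-*-∑ P.elems Q.elems (CP.walksFrom CP.[≤] m) (CQ.walksFrom CQ.[≤] m)))

  private
    ⋖-×ʳ⁻ : ∀ {p y q} → (p , y) CPQ.⋖ (p , q) → y CQ.⋖ q
    ⋖-×ʳ⁻ {p} (((_ , y≤q) , y≢q) , none) =
      (y≤q , λ y≡q → y≢q (cong (p ,_) y≡q)) ,
      λ z ((y≤z , y≢z) , (z≤q , z≢q)) → none (p , z) (((≼P.refl , y≤z) , λ e → y≢z (cong proj₂ e)) ,
                                                      ((≼P.refl , z≤q) , λ e → z≢q (cong proj₂ e)))

    ⋖-×ʳ⁺ : ∀ {p y q} → y CQ.⋖ q → (p , y) CPQ.⋖ (p , q)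
    ⋖-×ʳ⁺ ((y≤q , y≢q) , none) =
      ((≼P.refl , y≤q) , λ e → y≢q (cong proj₂ e)) ,
      λ (a , b) (((p≤a , y≤b) , py≢ab) , ((a≤p , b≤q) , ab≢pq)) →
        none b ((y≤b , λ y≡b → py≢ab (cong₂ _,_ (≼P.antisym p≤a a≤p) y≡b)) ,
                (b≤q , λ b≡q → ab≢pq (cong₂ _,_ (≼P.antisym a≤p p≤a) b≡q)))

    ⋖-×ˡ⁻ : ∀ {x q p} → (x , q) CPQ.⋖ (p , q) → x CP.⋖ p
    ⋖-×ˡ⁻ {q = q} (((x≤p , _) , x≢p) , none) =
      (x≤p , λ x≡p → x≢p (cong (_, q) x≡p)) ,
      λ z ((x≤z , x≢z) , (z≤p , z≢p)) → none (z , q) (((x≤z , ≼Q.refl) , λ e → x≢z (cong proj₁ e)) ,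
                                                      ((z≤p , ≼Q.refl) , λ e → z≢p (cong proj₁ e)))

    ⋖-×ˡ⁺ : ∀ {x q p} → x CP.⋖ p → (x , q) CPQ.⋖ (p , q)
    ⋖-×ˡ⁺ ((x≤p , x≢p) , none) =
      ((x≤p , ≼Q.refl) , λ e → x≢p (cong proj₁ e)) ,
      λ (a , b) (((x≤a , q≤b) , xq≢ab) , ((a≤p , b≤q) , ab≢pq)) →
        none a ((x≤a , λ x≡a → xq≢ab (cong₂ _,_ x≡a (≼Q.antisym q≤b b≤q))) ,
                (a≤p , λ a≡p → ab≢pq (cong₂ _,_ a≡p (≼Q.antisym b≤q q≤b))))

    -- (x , q) lies strictly between (x , y) and (p , q).
    ¬⋖-× : ∀ {x y p q} → x ≢ p → y ≢ q → ¬ (x , y) CPQ.⋖ (p , q)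
    ¬⋖-× {x} {q = q} x≢p y≢q (((x≤p , y≤q) , _) , none) =
      none (x , q) (((≼P.refl , y≤q) , λ e → y≢q (cong proj₂ e)) , ((x≤p , ≼Q.refl) , λ e → x≢p (cong proj₁ e)))

  𝟙⋖-× : ∀ x y p q →
    𝟙[ (x , y) CPQ.⋖? (p , q) ] ≡ 𝟙[ p P.≟ x ] * 𝟙[ y CQ.⋖? q ] + 𝟙[ x CP.⋖? p ] * 𝟙[ q Q.≟ y ]
  𝟙⋖-× x y p q = split (p P.≟ x) (q Q.≟ y)
    where
    split : (p≟x : Dec (p ≡ x)) (q≟y : Dec (q ≡ y)) →
            𝟙[ (x , y) CPQ.⋖? (p , q) ] ≡ 𝟙[ p≟x ] * 𝟙[ y CQ.⋖? q ] + 𝟙[ x CP.⋖? p ] * 𝟙[ q≟y ]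
    split (yes refl) q≟y = begin
      𝟙[ (x , y) CPQ.⋖? (x , q) ]
        ≡⟨ 𝟙[]-⇔ ((x , y) CPQ.⋖? (x , q)) (y CQ.⋖? q) ⋖-×ʳ⁻ ⋖-×ʳ⁺ ⟩
      𝟙[ y CQ.⋖? q ]
        ≡⟨ +-identityʳ _ ⟨
      𝟙[ y CQ.⋖? q ] + 0
        ≡⟨ cong (λ c → 𝟙[ y CQ.⋖? q ] + c * 𝟙[ q≟y ]) (𝟙[no] (x CP.⋖? x) (λ ((_ , x≢x) , _) → x≢x refl)) ⟨
      𝟙[ y CQ.⋖? q ] + 𝟙[ x CP.⋖? x ] * 𝟙[ q≟y ]
        ≡⟨ cong (_+ 𝟙[ x CP.⋖? x ] * 𝟙[ q≟y ]) (*-identityˡ _) ⟨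
      1 * 𝟙[ y CQ.⋖? q ] + 𝟙[ x CP.⋖? x ] * 𝟙[ q≟y ] ∎
      where open ≡-Reasoning
    split (no p≢x) (yes refl) =
      trans (𝟙[]-⇔ ((x , y) CPQ.⋖? (p , y)) (x CP.⋖? p) ⋖-×ˡ⁻ ⋖-×ˡ⁺) (sym (*-identityʳ _))
    split (no p≢x) (no q≢y) =
      trans (𝟙[no] ((x , y) CPQ.⋖? (p , q)) (¬⋖-× (p≢x ∘ sym) (q≢y ∘ sym))) (sym (*-zeroʳ 𝟙[ x CP.⋖? p ]))

  ddeg-× : ∀ p q → PQ.ddeg (p , q) ≡ P.ddeg p + Q.ddeg q
  ddeg-× p q = begin
    PQ.ddeg (p , q)
      ≡⟨ CPQ.ddeg≡∑𝟙⋖ (p , q) ⟩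
    ∑[ z ∈ PQ.elems ] 𝟙[ z CPQ.⋖? (p , q) ]
      ≡⟨ ∑-× (λ z → 𝟙[ z CPQ.⋖? (p , q) ]) ⟩
    ∑[ x ∈ P.elems ] ∑[ y ∈ Q.elems ] 𝟙[ (x , y) CPQ.⋖? (p , q) ]
      ≡⟨ ∑-cong P.elems (λ x → trans (∑-cong Q.elems (λ y → 𝟙⋖-× x y p q)) (∑-distrib-+ Q.elems _ _)) ⟩
    ∑[ x ∈ P.elems ] (∑[ y ∈ Q.elems ] (δP x * ⋖Q y) + ∑[ y ∈ Q.elems ] (⋖P x * δQ y))
      ≡⟨ ∑-distrib-+ P.elems _ _ ⟩
    ∑[ x ∈ P.elems ] ∑[ y ∈ Q.elems ] (δP x * ⋖Q y) + ∑[ x ∈ P.elems ] ∑[ y ∈ Q.elems ] (⋖P x * δQ y)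
      ≡⟨ cong₂ _+_ (∑-*-∑ P.elems Q.elems δP ⋖Q) (∑-*-∑ P.elems Q.elems ⋖P δQ) ⟩
    ∑[ x ∈ P.elems ] δP x * ∑[ y ∈ Q.elems ] ⋖Q y + ∑[ x ∈ P.elems ] ⋖P x * ∑[ y ∈ Q.elems ] δQ y
      ≡⟨ cong₂ _+_ (cong₂ _*_ (CP.∑𝟙[≟]≡1 p) (sym (CQ.ddeg≡∑𝟙⋖ q)))
                   (cong₂ _*_ (sym (CP.ddeg≡∑𝟙⋖ p)) (CQ.∑𝟙[≟]≡1 q)) ⟩
    1 * Q.ddeg q + P.ddeg p * 1
      ≡⟨ trans (cong₂ _+_ (*-identityˡ (Q.ddeg q)) (*-identityʳ (P.ddeg p))) (+-comm (Q.ddeg q) (P.ddeg p)) ⟩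
    P.ddeg p + Q.ddeg q ∎
    where
    open ≡-Reasoning
    δP ⋖P : P.Carrier → ℕ
    δP x = 𝟙[ p P.≟ x ]
    ⋖P x = 𝟙[ x CP.⋖? p ]
    δQ ⋖Q : Q.Carrier → ℕ
    δQ y = 𝟙[ q Q.≟ y ]
    ⋖Q y = 𝟙[ y CQ.⋖? q ]

  ∑ddeg-× : IPQ.∑ddeg ≡ IP.∑ddeg * CQ.#elems + CP.#elems * IQ.∑ddeg
  ∑ddeg-× = begin
    ∑[ z ∈ PQ.elems ] PQ.ddeg z
      ≡⟨ ∑-× PQ.ddeg ⟩
    ∑[ x ∈ P.elems ] ∑[ y ∈ Q.elems ] PQ.ddeg (x , y)
      ≡⟨ ∑-cong P.elems (λ x → trans (∑-cong Q.elems (λ y → trans (ddeg-× x y)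
                                        (cong₂ _+_ (sym (*-identityʳ (P.ddeg x))) (sym (*-identityˡ (Q.ddeg y))))))
                                     (∑-distrib-+ Q.elems _ _)) ⟩
    ∑[ x ∈ P.elems ] (∑[ y ∈ Q.elems ] (P.ddeg x * 1) + ∑[ y ∈ Q.elems ] (1 * Q.ddeg y))
      ≡⟨ ∑-distrib-+ P.elems _ _ ⟩
    ∑[ x ∈ P.elems ] ∑[ y ∈ Q.elems ] (P.ddeg x * 1) + ∑[ x ∈ P.elems ] ∑[ y ∈ Q.elems ] (1 * Q.ddeg y)
      ≡⟨ cong₂ _+_ (∑-*-∑ P.elems Q.elems P.ddeg CQ.one) (∑-*-∑ P.elems Q.elems CP.one Q.ddeg) ⟩
    IP.∑ddeg * ∑[ y ∈ Q.elems ] 1 + ∑[ x ∈ P.elems ] 1 * IQ.∑ddeg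
      ≡⟨ cong₂ _+_ (cong (IP.∑ddeg *_) (length≡∑1 Q.elems)) (cong (_* IQ.∑ddeg) (length≡∑1 P.elems)) ⟨
    IP.∑ddeg * CQ.#elems + CP.#elems * IQ.∑ddeg ∎
    where open ≡-Reasoning

  private
    markedDdegP : ℕ → ℕ → ℕ
    markedDdegP i l = ∑[ p ∈ P.elems ] (P.ddeg p * (CP.walksInto CP.[≤] CP.one i p * CP.walksFrom CP.[≤] l p))

    markedDdegQ : ℕ → ℕ → ℕ
    markedDdegQ i l = ∑[ q ∈ Q.elems ] (Q.ddeg q * (CQ.walksInto CQ.[≤] CQ.one i q * CQ.walksFrom CQ.[≤] l q))

    markedDdeg-× : ∀ i l →
      ∑[ z ∈ PQ.elems ] (PQ.ddeg z * (CPQ.walksInto CPQ.[≤] CPQ.one i z * CPQ.walksFrom CPQ.[≤] l z)) ≡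
      markedDdegP i l * CQ.#multichains (i + l) + CP.#multichains (i + l) * markedDdegQ i l
    markedDdeg-× i l = begin
      ∑[ z ∈ PQ.elems ] (PQ.ddeg z * (CPQ.walksInto CPQ.[≤] CPQ.one i z * CPQ.walksFrom CPQ.[≤] l z))
        ≡⟨ ∑-× _ ⟩
      ∑[ x ∈ P.elems ] ∑[ y ∈ Q.elems ]
        (PQ.ddeg (x , y) * (CPQ.walksInto CPQ.[≤] CPQ.one i (x , y) * CPQ.walksFrom CPQ.[≤] l (x , y)))
        ≡⟨ ∑-cong P.elems (λ x → trans (∑-cong Q.elems (λ y → trans
             (cong₂ _*_ (ddeg-× x y) (cong₂ _*_ (walksInto-[≤]-× i x y) (walksFrom-[≤]-× l x y)))
             (split (P.ddeg x) (Q.ddeg y) (IP x) (IQ y) (FP x) (FQ y))))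
             (∑-distrib-+ Q.elems _ _)) ⟩
      ∑[ x ∈ P.elems ] (∑[ y ∈ Q.elems ] (P.ddeg x * (IP x * FP x) * (IQ y * FQ y))
                        + ∑[ y ∈ Q.elems ] (IP x * FP x * (Q.ddeg y * (IQ y * FQ y))))
        ≡⟨ ∑-distrib-+ P.elems _ _ ⟩
      ∑[ x ∈ P.elems ] ∑[ y ∈ Q.elems ] (P.ddeg x * (IP x * FP x) * (IQ y * FQ y))
        + ∑[ x ∈ P.elems ] ∑[ y ∈ Q.elems ] (IP x * FP x * (Q.ddeg y * (IQ y * FQ y)))
        ≡⟨ cong₂ _+_ (∑-*-∑ P.elems Q.elems _ _) (∑-*-∑ P.elems Q.elems _ _) ⟩
      markedDdegP i l * ∑[ y ∈ Q.elems ] (IQ y * FQ y) + ∑[ x ∈ P.elems ] (IP x * FP x) * markedDdegQ i l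
        ≡⟨ cong₂ _+_ (cong (markedDdegP i l *_) (CQ.∑-walksInto-walksFrom≡#multichains i l))
                     (cong (_* markedDdegQ i l) (CP.∑-walksInto-walksFrom≡#multichains i l)) ⟩
      markedDdegP i l * CQ.#multichains (i + l) + CP.#multichains (i + l) * markedDdegQ i l ∎
      where
      open ≡-Reasoning
      IP = CP.walksInto CP.[≤] CP.one i
      FP = CP.walksFrom CP.[≤] l
      IQ = CQ.walksInto CQ.[≤] CQ.one i
      FQ = CQ.walksFrom CQ.[≤] l
      split : ∀ d e a b c f → (d + e) * ((a * b) * (c * f)) ≡ d * (a * c) * (b * f) + a * c * (e * (b * f))
      split = solve-∀

  ∑ddeg*#multichainsThrough-× : ∀ m →
    ∑[ z ∈ PQ.elems ] (PQ.ddeg z * CPQ.#multichainsThrough m z) ≡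
    ∑[ p ∈ P.elems ] (P.ddeg p * CP.#multichainsThrough m p) * CQ.#multichains m +
    CP.#multichains m * ∑[ q ∈ Q.elems ] (Q.ddeg q * CQ.#multichainsThrough m q)
  ∑ddeg*#multichainsThrough-× m = begin
    ∑[ z ∈ PQ.elems ] (PQ.ddeg z * CPQ.#multichainsThrough m z)
      ≡⟨ CPQ.∑-*-#multichainsThrough m PQ.ddeg ⟩
    ∑[ i + l ≡ m ] ∑[ z ∈ PQ.elems ] (PQ.ddeg z * (CPQ.walksInto CPQ.[≤] CPQ.one i z * CPQ.walksFrom CPQ.[≤] l z))
      ≡⟨ ∑antidiagonal-cong m (λ i l i+l≡m → trans (markedDdeg-× i l)
           (cong (λ n → markedDdegP i l * CQ.#multichains n + CP.#multichains n * markedDdegQ i l) i+l≡m)) ⟩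
    ∑[ i + l ≡ m ] (markedDdegP i l * CQ.#multichains m + CP.#multichains m * markedDdegQ i l)
      ≡⟨ ∑antidiagonal-distrib-+ m _ _ ⟩
    ∑[ i + l ≡ m ] (markedDdegP i l * CQ.#multichains m) + ∑[ i + l ≡ m ] (CP.#multichains m * markedDdegQ i l)
      ≡⟨ cong₂ _+_ (sym (*-distribʳ-∑antidiagonal (CQ.#multichains m) m markedDdegP))
                   (sym (*-distribˡ-∑antidiagonal (CP.#multichains m) m markedDdegQ)) ⟩
    (∑[ i + l ≡ m ] markedDdegP i l) * CQ.#multichains m + CP.#multichains m * ∑[ i + l ≡ m ] markedDdegQ i l
      ≡⟨ cong₂ _+_ (cong (_* CQ.#multichains m) (sym (CP.∑-*-#multichainsThrough m P.ddeg)))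
                   (cong (CP.#multichains m *_) (sym (CQ.∑-*-#multichainsThrough m Q.ddeg))) ⟩
    ∑[ p ∈ P.elems ] (P.ddeg p * CP.#multichainsThrough m p) * CQ.#multichains m +
    CP.#multichains m * ∑[ q ∈ Q.elems ] (Q.ddeg q * CQ.#multichainsThrough m q) ∎
    where open ≡-Reasoning

  MultichainIdentity-× : ∀ m → IP.MultichainIdentity m → IQ.MultichainIdentity m → IPQ.MultichainIdentity m
  MultichainIdentity-× m identityP identityQ = begin
    CPQ.#elems * ∑[ z ∈ PQ.elems ] (PQ.ddeg z * CPQ.#multichainsThrough m z)
      ≡⟨ cong₂ _*_ #elems-× (∑ddeg*#multichainsThrough-× m) ⟩
    CP.#elems * CQ.#elems * (EP * CQ.#multichains m + CP.#multichains m * EQ)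
      ≡⟨ combine CP.#elems CQ.#elems (CP.#multichains m) (CQ.#multichains m) EP EQ IP.∑ddeg IQ.∑ddeg (suc m)
                 identityP identityQ ⟩
    suc m * (CP.#multichains m * CQ.#multichains m) * (IP.∑ddeg * CQ.#elems + CP.#elems * IQ.∑ddeg)
      ≡⟨ cong₂ (λ c s → suc m * c * s) (#multichains-× m) ∑ddeg-× ⟨
    suc m * CPQ.#multichains m * IPQ.∑ddeg ∎
    where
    open ≡-Reasoning
    EP = ∑[ p ∈ P.elems ] (P.ddeg p * CP.#multichainsThrough m p)
    EQ = ∑[ q ∈ Q.elems ] (Q.ddeg q * CQ.#multichainsThrough m q)
    combine : ∀ nP nQ mP mQ eP eQ sP sQ k → nP * eP ≡ k * mP * sP → nQ * eQ ≡ k * mQ * sQ →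
              nP * nQ * (eP * mQ + mP * eQ) ≡ k * (mP * mQ) * (sP * nQ + nP * sQ)
    combine nP nQ mP mQ eP eQ sP sQ k hP hQ = begin
      nP * nQ * (eP * mQ + mP * eQ)                    ≡⟨ regroup nP nQ mP mQ eP eQ ⟩
      nP * eP * (nQ * mQ) + nQ * eQ * (nP * mP)        ≡⟨ cong₂ (λ a b → a * (nQ * mQ) + b * (nP * mP)) hP hQ ⟩
      k * mP * sP * (nQ * mQ) + k * mQ * sQ * (nP * mP) ≡⟨ collect nP nQ mP mQ sP sQ k ⟩
      k * (mP * mQ) * (sP * nQ + nP * sQ)              ∎
      where
      regroup : ∀ nP nQ mP mQ eP eQ → nP * nQ * (eP * mQ + mP * eQ) ≡ nP * eP * (nQ * mQ) + nQ * eQ * (nP * mP)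
      regroup = solve-∀
      collect : ∀ nP nQ mP mQ sP sQ k →
                k * mP * sP * (nQ * mQ) + k * mQ * sQ * (nP * mP) ≡ k * (mP * mQ) * (sP * nQ + nP * sQ)
      collect = solve-∀

proposition1p10 : (P Q : FinPoset) → mCDE P → mCDE Q → mCDE (P ×P Q)
proposition1p10 P Q mcdeP mcdeQ =
  IPQ.ChainIdentity⇒mCDE (IPQ.MultichainIdentity⇒ChainIdentity (λ m →
    Product.MultichainIdentity-× P Q m (multichainIdentity P mcdeP m) (multichainIdentity Q mcdeQ m)))
  where
  module IPQ = Identities (P ×P Q)
  multichainIdentity : ∀ R → mCDE R → ∀ m → Identities.MultichainIdentity R m
  multichainIdentity R mcde = Identities.ChainIdentity⇒MultichainIdentity R (Identities.mCDE⇒ChainIdentity R mcde)
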